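{- For every $k\in\omega$ and all reals $\varepsilon,\delta>0$ there exists $n\in\omega$ such that for every finite set $I\subseteq\omega$ with $|I|>n$ there is a partition $2^I=a^0\cup a^1$ (with $a^0\cap a^1=\emptyset$) such that: (1) for every $X\subseteq 2^I$ with $|X|\le k$, $$\left|\frac{\left|\bigcap_{x\in X}(a^0+x)\right|}{2^{|I|}}-\frac{1}{2^{|X|}}\right|<\delta;$$ (2) for every distribution $m$ on $2^I$ with $\overline m\ge\varepsilon$ there exists a set $T_m\subseteq 2^I$ with $\frac{|T_m|}{2^{|I|}}>1-\delta$ such that for every $s\in T_m$, $$\left|\sum\{m(t):t\in a^0+s\}-\frac{\overline m}{2}\right|<\delta.$$
   Context: For a finite set $I$, $2^I$ is the set of functions $I\to\{0,1\}$, a group under coordinatewise addition modulo $2$; $A+x=\{a+x:a\in A\}$. A distribution on a finite set $S$ is a function $m:S\to\mathbb R$ with $0\le m(x)\le \frac{1}{|S|}$ for all $x\in S$ (so for $S=2^I$, $0\le m(x)\le 2^{ -|I|}$), and $\overline m=\sum_{s\in S}m(s)$.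
   Formalization: The parameters ε and δ and the values of every distribution m are rational rather than real. -}

module Defs where

open import Data.Bool using (Bool; true; false; _xor_; if_then_else_)
open import Data.Nat using (ℕ; zero; suc)
open import Data.Integer using (+_)
open import Data.List using (List; []; _∷_; map; concatMap; filter; length; foldr)
open import Data.Vec using (Vec; []; _∷_; zipWith)
open import Data.Rational using (ℚ; _/_; _+_; _*_; 0ℚ; 1ℚ; ½)

-- 2^I for |I| = N, realised as Bool-vectors indexed by I ≅ Fin N
Cube : ℕ → Set
Cube N = Vec Bool N

_⊕_ : ∀ {N} → Cube N → Cube N → Cube N
x ⊕ y = zipWith _xor_ x y

allCube : (N : ℕ) → List (Cube N)
allCube zero = [] ∷ []
allCube (suc N) = concatMap (λ v → (false ∷ v) ∷ (true ∷ v) ∷ []) (allCube N)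

Subset : ℕ → Set
Subset N = Cube N → Bool

card : ∀ {N} → Subset N → ℕ
card {N} A = length (filter (λ x → A x Data.Bool.≟ true) (allCube N))
  where import Data.Bool

ℕ→ℚ : ℕ → ℚ
ℕ→ℚ n = + n / 1

inv2^ : ℕ → ℚ
inv2^ zero = 1ℚ
inv2^ (suc n) = ½ * inv2^ n

allL : ∀ {A : Set} → (A → Bool) → List A → Bool
allL p [] = true
allL p (x ∷ xs) = if p x then allL p xs else false

-- ⋂_{x ∈ X} (A + x), where y ∈ A + x iff y ⊕ x ∈ A
⋂translates : ∀ {N} → Subset N → Subset N → Subset N
⋂translates {N} A X y = allL (λ x → if X x then A (y ⊕ x) else true) (allCube N)

translate : ∀ {N} → Subset N → Cube N → Subset N
translate A s t = A (t ⊕ s)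

sumOver : ∀ {N} → Subset N → (Cube N → ℚ) → ℚ
sumOver {N} B m = foldr (λ t acc → (if B t then m t else 0ℚ) + acc) 0ℚ (allCube N)

mass : ∀ {N} → (Cube N → ℚ) → ℚ
mass m = sumOver (λ _ → true) m

-- Encode a subset F of the cube by its characteristic function, let σ = ±1 be its sign, and let
-- corr F S = ∑_y ∏_{x ∈ S} σ (y ⊕ x) be its correlation with a list S of points.
-- Expanding the indicator ∏_{x ∈ X} (1 + σ (y ⊕ x)) / 2 of ⋂_{x ∈ X} (F + x) shows that (1) holds as soon as
-- ∣corr F S∣ ≤ τ for all duplicate-free S with 1 ≤ |S| ≤ K and τ / 2^N is small. For pairs S = [t, t′] the same
-- bound gives ∑_s bias(s)² ≤ 1 + τ, where bias(s) = 2 ∑{m(t) : t ∈ F + s} - m̄, and (2) follows by Chebyshev.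
-- Such an F exists by averaging over all subsets: the mean of corr F S ^ m, m = 2K + 2, counts the m-tuples ys in
-- which every point of ys ⊕ S occurs an even number of times. In such a tuple each entry that is far from all
-- later entries (free) is matched with its own earlier non-free entry, so at most m / 2 entries are free; hence at
-- most (2W)^m 2^{N(K+1)} tuples are counted, which is below τ^m once N is large.

module Submission where

open import Defs
open import Data.Bool using (Bool; true; false)
open import Data.Nat using (ℕ)
open import Data.Product using (Σ; _×_; ∃)
open import Relation.Binary.PropositionalEquality using (_≡_)
open import Data.Rational using (ℚ; _<_; _≤_; _-_; _*_; ∣_∣; 0ℚ; 1ℚ; ½)
import Data.Nat

open import Algebra.Bundles using (CommutativeRing)
open import Data.Bool as Bool using (not; _xor_; if_then_else_)
import Data.Bool.Properties as Boolₚ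
open import Data.Empty using (⊥; ⊥-elim)
open import Data.Integer as ℤ using (+<+; +≤+)
import Data.Integer.Properties as ℤₚ
open import Data.List as List
  using (List; []; _∷_; _++_; map; concatMap; filter; length; cartesianProductWith; applyUpTo)
import Data.List.Properties as Listₚ
open import Data.List.Membership.Propositional using (_∈_; _∉_; find)
open import Data.List.Membership.Propositional.Properties
open import Data.List.Relation.Unary.All as All using (All; []; _∷_)
open import Data.List.Relation.Unary.All.Properties using (¬Any⇒All¬; ¬All⇒Any¬)
import Data.List.Relation.Unary.All.Properties as Allₚ
open import Data.List.Relation.Binary.Sublist.Propositional using (_⊆_; []; _∷_; _∷ʳ_; minimum)
import Data.List.Relation.Binary.Sublist.Propositional.Properties as Sublistₚ
open import Data.List.Relation.Unary.AllPairs as AllPairs using (AllPairs; []; _∷_)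
open import Data.List.Relation.Unary.Any using (Any; here; there; _─_; any?)
open import Data.List.Relation.Unary.Unique.Propositional using (Unique)
open import Data.List.Relation.Unary.Unique.Propositional.Properties using (Unique[x∷xs]⇒x∉xs)
import Data.List.Relation.Unary.Unique.Propositional.Properties as Uniqueₚ
import Data.List.Relation.Unary.Any as Any
import Data.List.Relation.Unary.Any.Properties as Anyₚ
open import Data.Nat as ℕ using (zero; suc; _∸_; z≤n; s≤s)
import Data.Nat.Properties as ℕₚ
open import Data.Nat.Coprimality using (1-coprimeTo)
import Data.Nat.Coprimality as Coprime
open import Data.Product using (_,_; proj₁; proj₂; ∃₂)
open import Data.Rational
open import Data.Rational.Properties
open import Algebra.Properties.CommutativeSemiring.Exp (CommutativeRing.commutativeSemiring +-*-commutativeRing)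
  using (_^_; ^-homo-*; ^-distrib-*; ^-assocʳ)
open import Data.Rational.Solver using (module +-*-Solver)
import Data.Rational.Unnormalised as ℚᵘ
import Data.Rational.Unnormalised.Properties as ℚᵘₚ
open import Data.Sum using (_⊎_; inj₁; inj₂)
open import Data.Vec using (Vec; []; _∷_; replicate)
import Data.Vec.Properties as Vecₚ
open import Function using (_∘_)
open import Relation.Binary.PropositionalEquality
  using (refl; sym; trans; cong; cong₂; subst; subst₂; _≢_; module ≡-Reasoning)
open import Relation.Nullary using (Dec; yes; no; does; ¬_; ¬?)
open import Relation.Nullary.Decidable using (dec-true; dec-false)

open +-*-Solver

private
  variable
    A B C : Set

-- ℕ→ℚ n normalises to mkℚ n 0, on which the order of ℚ and (via toℚᵘ) its ring operations compute directly.
private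
  mkℚ-ℕ : ℕ → ℚ
  mkℚ-ℕ n = mkℚ (ℤ.+ n) 0 (Coprime.sym (1-coprimeTo n))

  ℕ→ℚ≡mkℚ : ∀ n → ℕ→ℚ n ≡ mkℚ-ℕ n
  ℕ→ℚ≡mkℚ n = ↥p/↧p≡p (mkℚ-ℕ n)

ℕ→ℚ-+ : ∀ a b → ℕ→ℚ (a ℕ.+ b) ≡ ℕ→ℚ a + ℕ→ℚ b
ℕ→ℚ-+ a b rewrite ℕ→ℚ≡mkℚ a | ℕ→ℚ≡mkℚ b | ℕ→ℚ≡mkℚ (a ℕ.+ b) =
  toℚᵘ-injective (ℚᵘₚ.≃-trans (ℚᵘ.*≡* numerators) (ℚᵘₚ.≃-sym (toℚᵘ-homo-+ (mkℚ-ℕ a) (mkℚ-ℕ b))))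
  where
  numerators : ℤ.+ (a ℕ.+ b) ℤ.* ℤ.+ 1 ≡ (ℤ.+ a ℤ.* ℤ.+ 1 ℤ.+ ℤ.+ b ℤ.* ℤ.+ 1) ℤ.* ℤ.+ 1
  numerators rewrite ℤₚ.*-identityʳ (ℤ.+ (a ℕ.+ b)) | ℤₚ.*-identityʳ (ℤ.+ a)
                   | ℤₚ.*-identityʳ (ℤ.+ b) | ℤₚ.*-identityʳ (ℤ.+ a ℤ.+ ℤ.+ b) = refl

ℕ→ℚ-* : ∀ a b → ℕ→ℚ (a ℕ.* b) ≡ ℕ→ℚ a * ℕ→ℚ b
ℕ→ℚ-* a b rewrite ℕ→ℚ≡mkℚ a | ℕ→ℚ≡mkℚ b | ℕ→ℚ≡mkℚ (a ℕ.* b) =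
  toℚᵘ-injective (ℚᵘₚ.≃-trans (ℚᵘ.*≡* (cong (ℤ._* ℤ.+ 1) (ℤₚ.pos-* a b)))
                              (ℚᵘₚ.≃-sym (toℚᵘ-homo-* (mkℚ-ℕ a) (mkℚ-ℕ b))))

ℕ→ℚ-^ : ∀ a n → ℕ→ℚ (a ℕ.^ n) ≡ ℕ→ℚ a ^ n
ℕ→ℚ-^ a zero    = refl
ℕ→ℚ-^ a (suc n) = trans (ℕ→ℚ-* a (a ℕ.^ n)) (cong (ℕ→ℚ a *_) (ℕ→ℚ-^ a n))

ℕ→ℚ-mono-≤ : ∀ {a b} → a ℕ.≤ b → ℕ→ℚ a ≤ ℕ→ℚ b
ℕ→ℚ-mono-≤ {a} {b} a≤b rewrite ℕ→ℚ≡mkℚ a | ℕ→ℚ≡mkℚ b =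
  *≤* (ℤₚ.*-monoʳ-≤-nonNeg (ℤ.+ 1) (+≤+ a≤b))

ℕ→ℚ-mono-< : ∀ {a b} → a ℕ.< b → ℕ→ℚ a < ℕ→ℚ b
ℕ→ℚ-mono-< {a} {b} a<b rewrite ℕ→ℚ≡mkℚ a | ℕ→ℚ≡mkℚ b =
  *<* (ℤₚ.*-monoʳ-<-pos (ℤ.+ 1) (+<+ a<b))

ℕ→ℚ-nonNeg : ∀ n → 0ℚ ≤ ℕ→ℚ n
ℕ→ℚ-nonNeg n = ℕ→ℚ-mono-≤ {0} {n} z≤n

≤?-suc : ∀ n j → does (suc n ℕ.≤? suc j) ≡ does (n ℕ.≤? j)
≤?-suc n j with n ℕ.≤? j
... | yes n≤j = trans (dec-true  (suc n ℕ.≤? suc j) (s≤s n≤j))          (sym (dec-true  (n ℕ.≤? j) n≤j))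
... | no  n≰j = trans (dec-false (suc n ℕ.≤? suc j) (n≰j ∘ ℕ.s≤s⁻¹)) (sym (dec-false (n ℕ.≤? j) n≰j))

0≤1 : 0ℚ ≤ 1ℚ
0≤1 = *≤* (+≤+ z≤n)

0≤½ : 0ℚ ≤ ½
0≤½ = *≤* (+≤+ z≤n)

0<½ : 0ℚ < ½
0<½ = *<* (+<+ (s≤s z≤n))

nonNeg*nonNeg : ∀ {p q} → 0ℚ ≤ p → 0ℚ ≤ q → 0ℚ ≤ p * q
nonNeg*nonNeg {p} {q} 0≤p 0≤q = begin
  0ℚ    ≡⟨ sym (*-zeroʳ p) ⟩
  p * 0ℚ ≤⟨ *-monoˡ-≤-nonNeg p {{nonNegative 0≤p}} 0≤q ⟩
  p * q ∎
  where open ≤-Reasoning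

pos*pos : ∀ {p q} → 0ℚ < p → 0ℚ < q → 0ℚ < p * q
pos*pos {p} {q} 0<p 0<q = positive⁻¹ (p * q) {{pos*pos⇒pos p {{positive 0<p}} q {{positive 0<q}}}}

*-mono-≤-nonNeg : ∀ {p p′ q q′} → 0ℚ ≤ p → 0ℚ ≤ q → p ≤ p′ → q ≤ q′ → p * q ≤ p′ * q′
*-mono-≤-nonNeg {p} {p′} {q} {q′} 0≤p 0≤q p≤p′ q≤q′ = begin
  p * q   ≤⟨ *-monoˡ-≤-nonNeg p {{nonNegative 0≤p}} q≤q′ ⟩
  p * q′  ≤⟨ *-monoʳ-≤-nonNeg q′ {{nonNegative (≤-trans 0≤q q≤q′)}} p≤p′ ⟩
  p′ * q′ ∎
  where open ≤-Reasoning

x*x≡∣x∣*∣x∣ : ∀ x → x * x ≡ ∣ x ∣ * ∣ x ∣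
x*x≡∣x∣*∣x∣ x with ∣p∣≡p∨∣p∣≡-p x
... | inj₁ ∣x∣≡x  rewrite ∣x∣≡x  = refl
... | inj₂ ∣x∣≡-x rewrite ∣x∣≡-x = solve 1 (λ x → x :* x := (:- x) :* (:- x)) refl x

x*x-nonNeg : ∀ x → 0ℚ ≤ x * x
x*x-nonNeg x rewrite x*x≡∣x∣*∣x∣ x = nonNeg*nonNeg (0≤∣p∣ x) (0≤∣p∣ x)

p≤∣p∣ : ∀ p → p ≤ ∣ p ∣
p≤∣p∣ p with ∣p∣≡p∨∣p∣≡-p p
... | inj₁ ∣p∣≡p  = ≤-reflexive (sym ∣p∣≡p)
... | inj₂ ∣p∣≡-p = ≤-trans p≤0 (0≤∣p∣ p)
  where
  p≤0 : p ≤ 0ℚ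
  p≤0 = ≤-trans (≤-reflexive (solve 1 (λ p → p := :- (:- p)) refl p))
                (neg-antimono-≤ (≤-trans (0≤∣p∣ p) (≤-reflexive ∣p∣≡-p)))

^-nonNeg : ∀ {x} n → 0ℚ ≤ x → 0ℚ ≤ x ^ n
^-nonNeg zero    0≤x = 0≤1
^-nonNeg (suc n) 0≤x = nonNeg*nonNeg 0≤x (^-nonNeg n 0≤x)

^-pos : ∀ {x} n → 0ℚ < x → 0ℚ < x ^ n
^-pos zero    0<x = *<* (+<+ (s≤s z≤n))
^-pos (suc n) 0<x = pos*pos 0<x (^-pos n 0<x)

^-monoˡ-≤ : ∀ {x y} n → 0ℚ ≤ x → x ≤ y → x ^ n ≤ y ^ n
^-monoˡ-≤ zero    0≤x x≤y = ≤-refl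
^-monoˡ-≤ (suc n) 0≤x x≤y = *-mono-≤-nonNeg 0≤x (^-nonNeg n 0≤x) x≤y (^-monoˡ-≤ n 0≤x x≤y)

^-monoʳ-≤ : ∀ {x i j} → 1ℚ ≤ x → i ℕ.≤ j → x ^ i ≤ x ^ j
^-monoʳ-≤ {x} {j = j} 1≤x z≤n = 1≤x^j j
  where
  1≤x^j : ∀ j → 1ℚ ≤ x ^ j
  1≤x^j zero    = ≤-refl
  1≤x^j (suc j) = *-mono-≤-nonNeg 0≤1 0≤1 1≤x (1≤x^j j)
^-monoʳ-≤ {x} 1≤x (s≤s i≤j) =
  *-monoˡ-≤-nonNeg x {{nonNegative (≤-trans 0≤1 1≤x)}} (^-monoʳ-≤ 1≤x i≤j)

^-double : ∀ x p → x ^ (p ℕ.+ p) ≡ (x * x) ^ p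
^-double x p = trans (^-homo-* x p p) (sym (^-distrib-* x x p))

^-even-nonNeg : ∀ x p → 0ℚ ≤ x ^ (p ℕ.+ p)
^-even-nonNeg x p rewrite ^-double x p = ^-nonNeg p (x*x-nonNeg x)

^-even-mono : ∀ {t x} p → 0ℚ ≤ t → t ≤ ∣ x ∣ → t ^ (p ℕ.+ p) ≤ x ^ (p ℕ.+ p)
^-even-mono {t} {x} p 0≤t t≤∣x∣ rewrite ^-double x p | ^-double t p | x*x≡∣x∣*∣x∣ x =
  ^-monoˡ-≤ p (nonNeg*nonNeg 0≤t 0≤t) (*-mono-≤-nonNeg 0≤t 0≤t t≤∣x∣ t≤∣x∣)

∑ : List A → (A → ℚ) → ℚ
∑ []       f = 0ℚ
∑ (x ∷ xs) f = f x + ∑ xs f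

∏ : List A → (A → ℚ) → ℚ
∏ []       f = 1ℚ
∏ (x ∷ xs) f = f x * ∏ xs f

syntax ∑ xs (λ x → e) = ∑[ x ← xs ] e
syntax ∏ xs (λ x → e) = ∏[ x ← xs ] e

∑-cong : ∀ (xs : List A) {f g : A → ℚ} → (∀ x → f x ≡ g x) → ∑ xs f ≡ ∑ xs g
∑-cong []       f≡g = refl
∑-cong (x ∷ xs) f≡g = cong₂ _+_ (f≡g x) (∑-cong xs f≡g)

∏-cong : ∀ (xs : List A) {f g : A → ℚ} → (∀ x → f x ≡ g x) → ∏ xs f ≡ ∏ xs g
∏-cong []       f≡g = refl
∏-cong (x ∷ xs) f≡g = cong₂ _*_ (f≡g x) (∏-cong xs f≡g)

∑-++ : ∀ (xs ys : List A) f → ∑ (xs ++ ys) f ≡ ∑ xs f + ∑ ys f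
∑-++ []       ys f = sym (+-identityˡ _)
∑-++ (x ∷ xs) ys f = trans (cong (f x +_) (∑-++ xs ys f)) (sym (+-assoc (f x) _ _))

∏-++ : ∀ (xs ys : List A) f → ∏ (xs ++ ys) f ≡ ∏ xs f * ∏ ys f
∏-++ []       ys f = sym (*-identityˡ _)
∏-++ (x ∷ xs) ys f = trans (cong (f x *_) (∏-++ xs ys f)) (sym (*-assoc (f x) _ _))

∑-map : ∀ (g : A → B) xs f → ∑ (map g xs) f ≡ ∑[ x ← xs ] f (g x)
∑-map g []       f = refl
∑-map g (x ∷ xs) f = cong (f (g x) +_) (∑-map g xs f)

∏-map : ∀ (g : A → B) xs f → ∏ (map g xs) f ≡ ∏[ x ← xs ] f (g x)
∏-map g []       f = refl
∏-map g (x ∷ xs) f = cong (f (g x) *_) (∏-map g xs f)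

∑-concatMap : ∀ (g : A → List B) xs f → ∑ (concatMap g xs) f ≡ ∑[ x ← xs ] ∑ (g x) f
∑-concatMap g []       f = refl
∑-concatMap g (x ∷ xs) f =
  trans (∑-++ (g x) (concatMap g xs) f) (cong (∑ (g x) f +_) (∑-concatMap g xs f))

∑-cartesianProductWith : ∀ (g : A → B → C) xs ys f →
  ∑ (cartesianProductWith g xs ys) f ≡ ∑[ x ← xs ] ∑[ y ← ys ] f (g x y)
∑-cartesianProductWith g []       ys f = refl
∑-cartesianProductWith g (x ∷ xs) ys f =
  trans (∑-++ (map (g x) ys) (cartesianProductWith g xs ys) f)
        (cong₂ _+_ (∑-map (g x) ys f) (∑-cartesianProductWith g xs ys f))

length-cartesianProductWith : ∀ (f : A → B → C) xs ys →
  length (cartesianProductWith f xs ys) ≡ length xs ℕ.* length ys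
length-cartesianProductWith f []       ys = refl
length-cartesianProductWith f (x ∷ xs) ys =
  trans (Listₚ.length-++ (map (f x) ys))
        (cong₂ ℕ._+_ (Listₚ.length-map (f x) ys) (length-cartesianProductWith f xs ys))

∑-zero : ∀ (xs : List A) → ∑[ x ← xs ] 0ℚ ≡ 0ℚ
∑-zero []       = refl
∑-zero (x ∷ xs) = trans (+-identityˡ _) (∑-zero xs)

∑-distrib-+ : ∀ (xs : List A) f g → ∑[ x ← xs ] (f x + g x) ≡ ∑ xs f + ∑ xs g
∑-distrib-+ []       f g = refl
∑-distrib-+ (x ∷ xs) f g = trans (cong (f x + g x +_) (∑-distrib-+ xs f g))
  (solve 4 (λ a b c d → (a :+ b) :+ (c :+ d) := (a :+ c) :+ (b :+ d)) refl (f x) (g x) (∑ xs f) (∑ xs g))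

*-distribˡ-∑ : ∀ c (xs : List A) f → c * ∑ xs f ≡ ∑[ x ← xs ] (c * f x)
*-distribˡ-∑ c []       f = *-zeroʳ c
*-distribˡ-∑ c (x ∷ xs) f = trans (*-distribˡ-+ c (f x) _) (cong (c * f x +_) (*-distribˡ-∑ c xs f))

*-distribʳ-∑ : ∀ c (xs : List A) f → ∑ xs f * c ≡ ∑[ x ← xs ] (f x * c)
*-distribʳ-∑ c xs f =
  trans (*-comm (∑ xs f) c) (trans (*-distribˡ-∑ c xs f) (∑-cong xs (λ x → *-comm c (f x))))

∑-comm : ∀ (xs : List A) (ys : List B) (f : A → B → ℚ) →
  ∑[ x ← xs ] ∑[ y ← ys ] f x y ≡ ∑[ y ← ys ] ∑[ x ← xs ] f x y
∑-comm []       ys f = sym (∑-zero ys)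
∑-comm (x ∷ xs) ys f =
  trans (cong (∑ ys (f x) +_) (∑-comm xs ys f)) (sym (∑-distrib-+ ys (f x) _))

∑-*-∑ : ∀ (xs : List A) (ys : List B) f g →
  ∑ xs f * ∑ ys g ≡ ∑[ x ← xs ] ∑[ y ← ys ] (f x * g y)
∑-*-∑ xs ys f g =
  trans (*-distribʳ-∑ (∑ ys g) xs f) (∑-cong xs (λ x → *-distribˡ-∑ (f x) ys g))

∑-const : ∀ (xs : List A) c → ∑[ x ← xs ] c ≡ ℕ→ℚ (length xs) * c
∑-const []       c = sym (*-zeroˡ c)
∑-const (x ∷ xs) c = begin
  c + ∑[ x ← xs ] c                 ≡⟨ cong (c +_) (∑-const xs c) ⟩
  c + ℕ→ℚ (length xs) * c           ≡⟨ solve 2 (λ c n → c :+ n :* c := (con 1ℚ :+ n) :* c) refl c (ℕ→ℚ (length xs)) ⟩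
  (1ℚ + ℕ→ℚ (length xs)) * c        ≡⟨ cong (_* c) (sym (ℕ→ℚ-+ 1 (length xs))) ⟩
  ℕ→ℚ (length (x ∷ xs)) * c         ∎
  where open ≡-Reasoning

∑-mono-≤ : ∀ (xs : List A) {f g : A → ℚ} → (∀ {x} → x ∈ xs → f x ≤ g x) → ∑ xs f ≤ ∑ xs g
∑-mono-≤ []       f≤g = ≤-refl
∑-mono-≤ (x ∷ xs) f≤g = +-mono-≤ (f≤g (here refl)) (∑-mono-≤ xs (f≤g ∘ there))

∑-nonNeg : ∀ (xs : List A) {f : A → ℚ} → (∀ x → 0ℚ ≤ f x) → 0ℚ ≤ ∑ xs f
∑-nonNeg xs {f} 0≤f = ≤-trans (≤-reflexive (sym (∑-zero xs))) (∑-mono-≤ xs (λ {x} _ → 0≤f x))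

∣∑∣≤∑∣∣ : ∀ (xs : List A) f → ∣ ∑ xs f ∣ ≤ ∑[ x ← xs ] ∣ f x ∣
∣∑∣≤∑∣∣ []       f = ≤-refl
∣∑∣≤∑∣∣ (x ∷ xs) f = ≤-trans (∣p+q∣≤∣p∣+∣q∣ (f x) _) (+-monoʳ-≤ ∣ f x ∣ (∣∑∣≤∑∣∣ xs f))

term≤∑ : ∀ {xs : List A} {x} f → (∀ y → 0ℚ ≤ f y) → x ∈ xs → f x ≤ ∑ xs f
term≤∑ {xs = y ∷ xs} f 0≤f (here refl) =
  ≤-trans (≤-reflexive (sym (+-identityʳ (f y)))) (+-monoʳ-≤ (f y) (∑-nonNeg xs 0≤f))
term≤∑ {xs = y ∷ xs} f 0≤f (there x∈xs) =
  ≤-trans (term≤∑ f 0≤f x∈xs) (≤-trans (≤-reflexive (sym (+-identityˡ _))) (+-monoˡ-≤ _ (0≤f y)))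

∑<∑⇒∃< : ∀ (xs : List A) {f g : A → ℚ} → ∑ xs f < ∑ xs g → ∃ λ x → x ∈ xs × f x < g x
∑<∑⇒∃< []       ∑f<∑g = ⊥-elim (<-irrefl refl ∑f<∑g)
∑<∑⇒∃< (x ∷ xs) {f} {g} ∑f<∑g with f x <? g x | ∑ xs f <? ∑ xs g
... | yes fx<gx | _ = x , here refl , fx<gx
... | no _ | yes ∑f<∑g′ = let y , y∈xs , fy<gy = ∑<∑⇒∃< xs ∑f<∑g′ in y , there y∈xs , fy<gy
... | no fx≮gx | no ∑f≮∑g′ = ⊥-elim (<-irrefl refl (<-≤-trans ∑f<∑g (+-mono-≤ (≮⇒≥ fx≮gx) (≮⇒≥ ∑f≮∑g′))))

𝟙 : Bool → ℚ
𝟙 true  = 1ℚ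
𝟙 false = 0ℚ

sgn : Bool → ℚ
sgn true  = 1ℚ
sgn false = - 1ℚ

𝟙-nonNeg : ∀ b → 0ℚ ≤ 𝟙 b
𝟙-nonNeg true  = 0≤1
𝟙-nonNeg false = ≤-refl

𝟙+𝟙∘not : ∀ b → 𝟙 b + 𝟙 (not b) ≡ 1ℚ
𝟙+𝟙∘not true  = refl
𝟙+𝟙∘not false = refl

𝟙≡½[1+sgn] : ∀ b → 𝟙 b ≡ ½ * (1ℚ + sgn b)
𝟙≡½[1+sgn] true  = refl
𝟙≡½[1+sgn] false = refl

sgn*sgn : ∀ b → sgn b * sgn b ≡ 1ℚ
sgn*sgn true  = refl
sgn*sgn false = refl

∏-sgn≡±1 : ∀ (xs : List A) (F : A → Bool) → ∏[ x ← xs ] sgn (F x) ≡ 1ℚ ⊎ ∏[ x ← xs ] sgn (F x) ≡ - 1ℚ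
∏-sgn≡±1 []       F = inj₁ refl
∏-sgn≡±1 (x ∷ xs) F with F x | ∏-sgn≡±1 xs F
... | true  | inj₁ ∏≡1  = inj₁ (cong (1ℚ *_) ∏≡1)
... | true  | inj₂ ∏≡-1 = inj₂ (cong (1ℚ *_) ∏≡-1)
... | false | inj₁ ∏≡1  = inj₂ (cong (- 1ℚ *_) ∏≡1)
... | false | inj₂ ∏≡-1 = inj₁ (cong (- 1ℚ *_) ∏≡-1)

∏-sgn≤1 : ∀ (xs : List A) (F : A → Bool) → ∏[ x ← xs ] sgn (F x) ≤ 1ℚ
∏-sgn≤1 xs F with ∏-sgn≡±1 xs F
... | inj₁ ∏≡1  = ≤-reflexive ∏≡1
... | inj₂ ∏≡-1 = ≤-trans (≤-reflexive ∏≡-1) (*≤* (ℤ.-≤+))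

length-filter≡∑𝟙 : ∀ (P : A → Bool) xs →
  ℕ→ℚ (length (filter (λ x → P x Bool.≟ true) xs)) ≡ ∑[ x ← xs ] 𝟙 (P x)
length-filter≡∑𝟙 P []       = refl
length-filter≡∑𝟙 P (x ∷ xs) with P x
... | true  = trans (ℕ→ℚ-+ 1 (length (filter (λ x → P x Bool.≟ true) xs)))
                    (cong (1ℚ +_) (length-filter≡∑𝟙 P xs))
... | false = trans (length-filter≡∑𝟙 P xs) (sym (+-identityˡ _))

module _ {N : ℕ} where

  infix 4 _≟ᶜ_
  _≟ᶜ_ : (x y : Cube N) → Dec (x ≡ y)
  _≟ᶜ_ = Vecₚ.≡-dec Bool._≟_

  0ᶜ : Cube N
  0ᶜ = replicate N false

  ⊕-comm : ∀ (x y : Cube N) → x ⊕ y ≡ y ⊕ x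
  ⊕-comm = Vecₚ.zipWith-comm Boolₚ.xor-comm

  ⊕-assoc : ∀ (x y z : Cube N) → (x ⊕ y) ⊕ z ≡ x ⊕ (y ⊕ z)
  ⊕-assoc = Vecₚ.zipWith-assoc Boolₚ.xor-assoc

  ⊕-identityʳ : ∀ (x : Cube N) → x ⊕ 0ᶜ ≡ x
  ⊕-identityʳ = Vecₚ.zipWith-identityʳ Boolₚ.xor-identityʳ

  δ : Cube N → Cube N → ℚ
  δ x y = 𝟙 (does (x ≟ᶜ y))

  δ-refl : ∀ x → δ x x ≡ 1ℚ
  δ-refl x = cong 𝟙 (dec-true (x ≟ᶜ x) refl)

  δ-nonNeg : ∀ x y → 0ℚ ≤ δ x y
  δ-nonNeg x y = 𝟙-nonNeg (does (x ≟ᶜ y))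

  δ-≢ : ∀ {x y} → x ≢ y → δ x y ≡ 0ℚ
  δ-≢ {x} {y} x≢y = cong 𝟙 (dec-false (x ≟ᶜ y) x≢y)

x⊕x≡0 : ∀ {N} (x : Cube N) → x ⊕ x ≡ 0ᶜ
x⊕x≡0 []      = refl
x⊕x≡0 (b ∷ x) = cong₂ _∷_ (Boolₚ.xor-same b) (x⊕x≡0 x)

module _ {N : ℕ} where

  x⊕[x⊕y]≡y : ∀ (x y : Cube N) → x ⊕ (x ⊕ y) ≡ y
  x⊕[x⊕y]≡y x y = begin
    x ⊕ (x ⊕ y) ≡⟨ sym (⊕-assoc x x y) ⟩
    (x ⊕ x) ⊕ y ≡⟨ cong (_⊕ y) (x⊕x≡0 x) ⟩
    0ᶜ ⊕ y      ≡⟨ ⊕-comm 0ᶜ y ⟩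
    y ⊕ 0ᶜ      ≡⟨ ⊕-identityʳ y ⟩
    y           ∎
    where open ≡-Reasoning

  [x⊕y]⊕y≡x : ∀ (x y : Cube N) → (x ⊕ y) ⊕ y ≡ x
  [x⊕y]⊕y≡x x y = trans (⊕-assoc x y y) (trans (cong (x ⊕_) (x⊕x≡0 y)) (⊕-identityʳ x))

  ⊕-cancelˡ : ∀ (x : Cube N) {y z} → x ⊕ y ≡ x ⊕ z → y ≡ z
  ⊕-cancelˡ x {y} {z} eq = trans (sym (x⊕[x⊕y]≡y x y)) (trans (cong (x ⊕_) eq) (x⊕[x⊕y]≡y x z))

  x⊕y≡0⇒x≡y : ∀ {x y : Cube N} → x ⊕ y ≡ 0ᶜ → x ≡ y
  x⊕y≡0⇒x≡y {x} eq = ⊕-cancelˡ x (trans (x⊕x≡0 x) (sym eq))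

  ⊕-interchange : ∀ (a b c d : Cube N) → (a ⊕ b) ⊕ (c ⊕ d) ≡ (a ⊕ c) ⊕ (b ⊕ d)
  ⊕-interchange a b c d = begin
    (a ⊕ b) ⊕ (c ⊕ d) ≡⟨ ⊕-assoc a b (c ⊕ d) ⟩
    a ⊕ (b ⊕ (c ⊕ d)) ≡⟨ cong (a ⊕_) (sym (⊕-assoc b c d)) ⟩
    a ⊕ ((b ⊕ c) ⊕ d) ≡⟨ cong (λ z → a ⊕ (z ⊕ d)) (⊕-comm b c) ⟩
    a ⊕ ((c ⊕ b) ⊕ d) ≡⟨ cong (a ⊕_) (⊕-assoc c b d) ⟩
    a ⊕ (c ⊕ (b ⊕ d)) ≡⟨ sym (⊕-assoc a c (b ⊕ d)) ⟩
    (a ⊕ c) ⊕ (b ⊕ d) ∎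
    where open ≡-Reasoning

∈-allCube : ∀ {N} (x : Cube N) → x ∈ allCube N
∈-allCube {zero}  []          = here refl
∈-allCube {suc N} (false ∷ x) = ∈-concatMap⁺ _ (Any.map (λ { refl → here refl }) (∈-allCube x))
∈-allCube {suc N} (true  ∷ x) = ∈-concatMap⁺ _ (Any.map (λ { refl → there (here refl) }) (∈-allCube x))

allCube-Unique : ∀ N → Unique (allCube N)
allCube-Unique zero    = [] ∷ []
allCube-Unique (suc N) = doubling-Unique (allCube-Unique N)
  where
  prefixes : Cube N → List (Cube (suc N))
  prefixes v = (false ∷ v) ∷ (true ∷ v) ∷ []

  tail-∈ : ∀ {b v} vs → b ∷ v ∈ concatMap prefixes vs → v ∈ vs
  tail-∈ vs = Any.map tail≡ ∘ ∈-concatMap⁻ prefixes {xs = vs}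
    where
    tail≡ : ∀ {b v w} → b ∷ v ∈ prefixes w → v ≡ w
    tail≡ (here eq)         = Vecₚ.∷-injectiveʳ eq
    tail≡ (there (here eq)) = Vecₚ.∷-injectiveʳ eq

  doubling-Unique : ∀ {vs} → Unique vs → Unique (concatMap prefixes vs)
  doubling-Unique {[]}     []             = []
  doubling-Unique {v ∷ vs} (v∉vs ∷ uvs) =
    ((λ ()) ∷ new false) ∷ new true ∷ doubling-Unique uvs
    where
    new : ∀ b → All (b ∷ v ≢_) (concatMap prefixes vs)
    new b = ¬Any⇒All¬ _ (Unique[x∷xs]⇒x∉xs (v∉vs ∷ uvs) ∘ tail-∈ vs)

∑-δ-∉ : ∀ {N} {x : Cube N} ys → x ∉ ys → ∑[ y ← ys ] δ y x ≡ 0ℚ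
∑-δ-∉ []       x∉ys = refl
∑-δ-∉ (y ∷ ys) x∉ys =
  trans (cong₂ _+_ (δ-≢ (λ y≡x → x∉ys (here (sym y≡x)))) (∑-δ-∉ ys (x∉ys ∘ there))) (+-identityˡ 0ℚ)

∑-δ : ∀ {N} {x : Cube N} {ys} → Unique ys → x ∈ ys → ∑[ y ← ys ] δ y x ≡ 1ℚ
∑-δ {ys = y ∷ ys} uys (here refl) =
  trans (cong₂ _+_ (δ-refl y) (∑-δ-∉ ys (Unique[x∷xs]⇒x∉xs uys))) (+-identityʳ 1ℚ)
∑-δ {ys = y ∷ ys} (y≢ys ∷ uys) (there x∈ys) =
  trans (cong₂ _+_ (δ-≢ (All.lookup y≢ys x∈ys)) (∑-δ uys x∈ys)) (+-identityˡ 1ℚ)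

∑-δ-allCube : ∀ {N} (x : Cube N) → ∑[ y ← allCube N ] δ y x ≡ 1ℚ
∑-δ-allCube {N} x = ∑-δ (allCube-Unique N) (∈-allCube x)

∑-sift : ∀ {N} (f : Cube N → ℚ) x → ∑[ y ← allCube N ] (f y * δ y x) ≡ f x
∑-sift {N} f x = begin
  ∑[ y ← allCube N ] (f y * δ y x) ≡⟨ ∑-cong (allCube N) f[y]δ≡f[x]δ ⟩
  ∑[ y ← allCube N ] (f x * δ y x) ≡⟨ sym (*-distribˡ-∑ (f x) (allCube N) (λ y → δ y x)) ⟩
  f x * ∑[ y ← allCube N ] δ y x   ≡⟨ cong (f x *_) (∑-δ-allCube x) ⟩
  f x * 1ℚ                          ≡⟨ *-identityʳ (f x) ⟩
  f x                               ∎
  where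
  open ≡-Reasoning
  f[y]δ≡f[x]δ : ∀ y → f y * δ y x ≡ f x * δ y x
  f[y]δ≡f[x]δ y with y ≟ᶜ x
  ... | yes refl = refl
  ... | no  _    = trans (*-zeroʳ (f y)) (sym (*-zeroʳ (f x)))

δ-shift : ∀ {N} (y y′ d : Cube N) → δ (y ⊕ y′) d ≡ δ y (d ⊕ y′)
δ-shift y y′ d with y ⊕ y′ ≟ᶜ d
... | yes refl  = sym (trans (cong (δ y) ([x⊕y]⊕y≡x y y′)) (δ-refl y))
... | no y⊕y′≢d = sym (δ-≢ (λ y≡d⊕y′ → y⊕y′≢d (trans (cong (_⊕ y′) y≡d⊕y′) ([x⊕y]⊕y≡x d y′))))

length-allCube : ∀ N → length (allCube N) ≡ 2 ℕ.^ N
length-allCube zero    = refl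
length-allCube (suc N) = trans (length-doubling (allCube N)) (cong (2 ℕ.*_) (length-allCube N))
  where
  length-doubling : ∀ (vs : List (Cube N)) →
    length (concatMap (λ v → (false ∷ v) ∷ (true ∷ v) ∷ []) vs) ≡ 2 ℕ.* length vs
  length-doubling []       = refl
  length-doubling (v ∷ vs) = trans (cong (2 ℕ.+_) (length-doubling vs)) (sym (ℕₚ.*-distribˡ-+ 2 1 (length vs)))

∑-allCube-const : ∀ N c → ∑[ _ ← allCube N ] c ≡ ℕ→ℚ (2 ℕ.^ N) * c
∑-allCube-const N c = trans (∑-const (allCube N) c) (cong (λ n → ℕ→ℚ n * c) (length-allCube N))

inv2^≡½^ : ∀ n → inv2^ n ≡ ½ ^ n
inv2^≡½^ zero    = refl
inv2^≡½^ (suc n) = cong (½ *_) (inv2^≡½^ n)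

inv2^-+ : ∀ a b → inv2^ (a ℕ.+ b) ≡ inv2^ a * inv2^ b
inv2^-+ a b rewrite inv2^≡½^ (a ℕ.+ b) | inv2^≡½^ a | inv2^≡½^ b = ^-homo-* ½ a b

inv2^-nonNeg : ∀ n → 0ℚ ≤ inv2^ n
inv2^-nonNeg n rewrite inv2^≡½^ n = ^-nonNeg n 0≤½

inv2^*2^ : ∀ n → inv2^ n * ℕ→ℚ (2 ℕ.^ n) ≡ 1ℚ
inv2^*2^ zero    = refl
inv2^*2^ (suc n) = begin
  ½ * inv2^ n * ℕ→ℚ (2 ℕ.^ n ℕ.+ (2 ℕ.^ n ℕ.+ 0))   ≡⟨ cong (λ k → ½ * inv2^ n * ℕ→ℚ (2 ℕ.^ n ℕ.+ k)) (ℕₚ.+-identityʳ (2 ℕ.^ n)) ⟩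
  ½ * inv2^ n * ℕ→ℚ (2 ℕ.^ n ℕ.+ 2 ℕ.^ n)           ≡⟨ cong (½ * inv2^ n *_) (ℕ→ℚ-+ (2 ℕ.^ n) (2 ℕ.^ n)) ⟩
  ½ * inv2^ n * (ℕ→ℚ (2 ℕ.^ n) + ℕ→ℚ (2 ℕ.^ n))     ≡⟨ solve 2 (λ i p → con ½ :* i :* (p :+ p) := i :* p) refl (inv2^ n) (ℕ→ℚ (2 ℕ.^ n)) ⟩
  inv2^ n * ℕ→ℚ (2 ℕ.^ n)                           ≡⟨ inv2^*2^ n ⟩
  1ℚ                                                 ∎
  where open ≡-Reasoning

inv2^-antimono : ∀ {a b} → a ℕ.≤ b → inv2^ b ≤ inv2^ a
inv2^-antimono {a} {b} a≤b = begin
  inv2^ b                   ≡⟨ cong inv2^ (sym (ℕₚ.m+[n∸m]≡n a≤b)) ⟩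
  inv2^ (a ℕ.+ (b ∸ a))     ≡⟨ inv2^-+ a (b ∸ a) ⟩
  inv2^ a * inv2^ (b ∸ a)   ≤⟨ *-monoˡ-≤-nonNeg (inv2^ a) {{nonNegative (inv2^-nonNeg a)}} (inv2^≤1 (b ∸ a)) ⟩
  inv2^ a * 1ℚ              ≡⟨ *-identityʳ (inv2^ a) ⟩
  inv2^ a                   ∎
  where
  open ≤-Reasoning
  inv2^≤1 : ∀ n → inv2^ n ≤ 1ℚ
  inv2^≤1 zero    = ≤-refl
  inv2^≤1 (suc n) = *-mono-≤-nonNeg {p′ = 1ℚ} 0≤½ (inv2^-nonNeg n) (*≤* (+≤+ (s≤s z≤n))) (inv2^≤1 n)

n<2^n : ∀ n → n ℕ.< 2 ℕ.^ n
n<2^n zero    = s≤s z≤n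
n<2^n (suc n) = ℕₚ.+-mono-≤ (ℕₚ.m^n>0 2 n) (ℕₚ.≤-trans (n<2^n n) (ℕₚ.m≤m+n (2 ℕ.^ n) 0))

-- For r = (a+1)/(d+1) in normal form, 1/2^(d+1) = mkℚ 1 k with k + 1 = 2^(d+1) > d + 1,
-- so cross-multiplication shows that it is below r.
∃inv2^< : ∀ r → 0ℚ < r → ∃ λ e → inv2^ e < r
∃inv2^< r@(mkℚ ℤ.+[1+ a ] d _) _ with 2 ℕ.^ suc d in 2^e≡ | ℕₚ.m^n>0 2 (suc d)
... | suc k | _ = suc d , subst (_< r) (sym inv2^e≡1/2^e) 1/2^e<r
  where
  1/2^e : ℚ
  1/2^e = mkℚ (ℤ.+ 1) k (1-coprimeTo (suc k))

  1/2^e*2^e : 1/2^e * ℕ→ℚ (suc k) ≡ 1ℚ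
  1/2^e*2^e rewrite ℕ→ℚ≡mkℚ (suc k) =
    toℚᵘ-injective (ℚᵘₚ.≃-trans (toℚᵘ-homo-* 1/2^e (mkℚ-ℕ (suc k)))
                                (ℚᵘ.*≡* (ℤₚ.*-assoc (ℤ.+ 1) (ℤ.+ suc k) (ℤ.+ 1))))

  inv2^e≡1/2^e : inv2^ (suc d) ≡ 1/2^e
  inv2^e≡1/2^e = begin
    inv2^ (suc d)                              ≡⟨ sym (*-identityʳ (inv2^ (suc d))) ⟩
    inv2^ (suc d) * 1ℚ                         ≡⟨ cong (inv2^ (suc d) *_) (sym (trans (*-comm (ℕ→ℚ (suc k)) 1/2^e) 1/2^e*2^e)) ⟩
    inv2^ (suc d) * (ℕ→ℚ (suc k) * 1/2^e)      ≡⟨ sym (*-assoc (inv2^ (suc d)) (ℕ→ℚ (suc k)) 1/2^e) ⟩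
    inv2^ (suc d) * ℕ→ℚ (suc k) * 1/2^e        ≡⟨ cong (λ n → inv2^ (suc d) * ℕ→ℚ n * 1/2^e) (sym 2^e≡) ⟩
    inv2^ (suc d) * ℕ→ℚ (2 ℕ.^ suc d) * 1/2^e  ≡⟨ cong (_* 1/2^e) (inv2^*2^ (suc d)) ⟩
    1ℚ * 1/2^e                                 ≡⟨ *-identityˡ 1/2^e ⟩
    1/2^e                                      ∎
    where open ≡-Reasoning

  1/2^e<r : 1/2^e < r
  1/2^e<r = *<* (subst₂ ℤ._<_ (sym (ℤₚ.*-identityˡ (ℤ.+ suc d))) (ℤₚ.pos-* (suc a) (suc k))
                  (+<+ (ℕₚ.<-≤-trans (subst (suc d ℕ.<_) 2^e≡ (n<2^n (suc d))) (ℕₚ.m≤n*m (suc k) (suc a)))))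
∃inv2^< (mkℚ (ℤ.+ 0) d _)   (*<* (+<+ ()))
∃inv2^< (mkℚ ℤ.-[1+ a ] d _) (*<* ())

-- Correlations, and their average over all subsets

module _ {N : ℕ} where

  corr : Subset N → List (Cube N) → ℚ
  corr F S = ∑[ y ← allCube N ] ∏[ x ← S ] sgn (F (y ⊕ x))

  odd : Cube N → List (Cube N) → Bool
  odd q []      = false
  odd q (x ∷ L) = does (x ≟ᶜ q) xor odd q L

  Balanced : List (Cube N) → Set
  Balanced L = All (λ q → odd q L ≡ false) L

  balanced? : ∀ L → Dec (Balanced L)
  balanced? L = All.all? (λ q → odd q L Bool.≟ false) L

  _[_≔_] : Subset N → Cube N → Bool → Subset N
  (F [ d ≔ b ]) q = if does (q ≟ᶜ d) then b else F q

  subsetsOn : List (Cube N) → List (Subset N)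
  subsetsOn []       = (λ _ → false) ∷ []
  subsetsOn (d ∷ ds) = concatMap (λ F → F [ d ≔ false ] ∷ F [ d ≔ true ] ∷ []) (subsetsOn ds)

  allSubsets : List (Subset N)
  allSubsets = subsetsOn (allCube N)

  #subsets : ℚ
  #subsets = ∑[ _ ← allSubsets ] 1ℚ

  #subsets-pos : 0ℚ < #subsets
  #subsets-pos = <-≤-trans (*<* (+<+ (s≤s z≤n))) (1≤∑ (allCube N))
    where
    1≤∑ : ∀ ds → 1ℚ ≤ ∑[ _ ← subsetsOn ds ] 1ℚ
    1≤∑ []       = ≤-reflexive (sym (+-identityʳ 1ℚ))
    1≤∑ (d ∷ ds) = begin
      1ℚ                                        ≤⟨ 1≤∑ ds ⟩
      ∑[ _ ← subsetsOn ds ] 1ℚ                  ≤⟨ ∑-mono-≤ (subsetsOn ds) (λ _ → 1≤1+1) ⟩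
      ∑[ _ ← subsetsOn ds ] (1ℚ + (1ℚ + 0ℚ))    ≡⟨ sym (∑-concatMap _ (subsetsOn ds) (λ _ → 1ℚ)) ⟩
      ∑[ _ ← subsetsOn (d ∷ ds) ] 1ℚ            ∎
      where
      open ≤-Reasoning
      1≤1+1 : 1ℚ ≤ 1ℚ + (1ℚ + 0ℚ)
      1≤1+1 = *≤* (+≤+ (s≤s z≤n))

  without : Cube N → List (Cube N) → List (Cube N)
  without d = filter (λ x → ¬? (x ≟ᶜ d))

  odd-without : ∀ {q d} L → q ≢ d → odd q (without d L) ≡ odd q L
  odd-without {q} {d} []      q≢d = refl
  odd-without {q} {d} (x ∷ L) q≢d with x ≟ᶜ d
  ... | yes refl = trans (odd-without L q≢d) (cong (_xor odd q L) (sym (dec-false (x ≟ᶜ q) (q≢d ∘ sym))))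
  ... | no  _    = cong (does (x ≟ᶜ q) xor_) (odd-without L q≢d)

  ∏-sgn-[≔] : ∀ F d b L → ∏[ x ← L ] sgn ((F [ d ≔ b ]) x)
            ≡ (if odd d L then sgn b else 1ℚ) * ∏[ x ← without d L ] sgn (F x)
  ∏-sgn-[≔] F d b []      = sym (*-identityˡ 1ℚ)
  ∏-sgn-[≔] F d b (x ∷ L) with x ≟ᶜ d | ∏-sgn-[≔] F d b L
  ... | yes refl | ih = trans (cong (sgn b *_) ih) (flip (odd x L))
    where
    R = ∏[ x ← without x L ] sgn (F x)
    flip : ∀ p → sgn b * ((if p then sgn b else 1ℚ) * R) ≡ (if not p then sgn b else 1ℚ) * R
    flip true  = trans (sym (*-assoc (sgn b) (sgn b) R)) (cong (_* R) (sgn*sgn b))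
    flip false = cong (sgn b *_) (*-identityˡ R)
  ... | no _ | ih = trans (cong (sgn (F x) *_) ih)
    (solve 3 (λ a c p → a :* (c :* p) := c :* (a :* p)) refl (sgn (F x))
           (if odd d L then sgn b else 1ℚ) (∏[ x ← without d L ] sgn (F x)))

  ∑-subsetsOn-∏-sgn : ∀ ds {q} L → q ∈ ds → odd q L ≡ true →
    ∑[ F ← subsetsOn ds ] ∏[ x ← L ] sgn (F x) ≡ 0ℚ
  ∑-subsetsOn-∏-sgn (d ∷ ds) {q} L q∈d∷ds oddqL = begin
    ∑[ F ← subsetsOn (d ∷ ds) ] ∏[ x ← L ] sgn (F x)
      ≡⟨ ∑-concatMap _ (subsetsOn ds) (λ F → ∏[ x ← L ] sgn (F x)) ⟩
    ∑[ F ← subsetsOn ds ] (∏[ x ← L ] sgn ((F [ d ≔ false ]) x) + (∏[ x ← L ] sgn ((F [ d ≔ true ]) x) + 0ℚ))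
      ≡⟨ ∑-cong (subsetsOn ds) split ⟩
    ∑[ F ← subsetsOn ds ] ((c false + c true) * ∏[ x ← without d L ] sgn (F x))
      ≡⟨ sym (*-distribˡ-∑ (c false + c true) (subsetsOn ds) (λ F → ∏[ x ← without d L ] sgn (F x))) ⟩
    (c false + c true) * R
      ≡⟨ vanish q∈d∷ds ⟩
    0ℚ ∎
    where
    open ≡-Reasoning
    c : Bool → ℚ
    c b = if odd d L then sgn b else 1ℚ
    R : ℚ
    R = ∑[ F ← subsetsOn ds ] ∏[ x ← without d L ] sgn (F x)
    split : ∀ F → ∏[ x ← L ] sgn ((F [ d ≔ false ]) x) + (∏[ x ← L ] sgn ((F [ d ≔ true ]) x) + 0ℚ)
                ≡ (c false + c true) * ∏[ x ← without d L ] sgn (F x)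
    split F rewrite ∏-sgn-[≔] F d false L | ∏-sgn-[≔] F d true L =
      solve 3 (λ a b p → a :* p :+ (b :* p :+ con 0ℚ) := (a :+ b) :* p) refl
            (c false) (c true) (∏[ x ← without d L ] sgn (F x))
    vanish : q ∈ d ∷ ds → (c false + c true) * R ≡ 0ℚ
    vanish (here refl) rewrite oddqL = *-zeroˡ R
    vanish (there q∈ds) with q ≟ᶜ d
    ... | yes refl rewrite oddqL = *-zeroˡ R
    ... | no  q≢d  = trans (cong ((c false + c true) *_) (∑-subsetsOn-∏-sgn ds (without d L) q∈ds
                             (trans (odd-without L q≢d) oddqL))) (*-zeroʳ (c false + c true))

  odd⇒∈ : ∀ {q} L → odd q L ≡ true → q ∈ L
  odd⇒∈ {q} (x ∷ L) oddqL with x ≟ᶜ q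
  ... | yes refl = here refl
  ... | no  _    = there (odd⇒∈ L oddqL)

  odd-++ : ∀ q L L′ → odd q (L ++ L′) ≡ odd q L xor odd q L′
  odd-++ q []      L′ = refl
  odd-++ q (x ∷ L) L′ = trans (cong (does (x ≟ᶜ q) xor_) (odd-++ q L L′))
                             (sym (Boolₚ.xor-assoc (does (x ≟ᶜ q)) (odd q L) (odd q L′)))

  odd-∉ : ∀ {q} L → q ∉ L → odd q L ≡ false
  odd-∉ []      q∉L = refl
  odd-∉ (x ∷ L) q∉L = cong₂ _xor_ (dec-false (x ≟ᶜ _) (λ x≡q → q∉L (here (sym x≡q)))) (odd-∉ L (q∉L ∘ there))

  odd-Unique : ∀ {q L} → Unique L → q ∈ L → odd q L ≡ true
  odd-Unique {L = x ∷ L} uL (here refl) =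
    cong₂ _xor_ (dec-true (x ≟ᶜ x) refl) (odd-∉ L (Unique[x∷xs]⇒x∉xs uL))
  odd-Unique {q} {x ∷ L} (x≢L ∷ uL) (there q∈L) =
    cong₂ _xor_ (dec-false (x ≟ᶜ q) (All.lookup x≢L q∈L)) (odd-Unique uL q∈L)

  odd-map-⊕ : ∀ a q L → odd (a ⊕ q) (map (a ⊕_) L) ≡ odd q L
  odd-map-⊕ a q []      = refl
  odd-map-⊕ a q (x ∷ L) = cong₂ _xor_ same-test (odd-map-⊕ a q L)
    where
    same-test : does (a ⊕ x ≟ᶜ a ⊕ q) ≡ does (x ≟ᶜ q)
    same-test with x ≟ᶜ q
    ... | yes refl = dec-true (a ⊕ x ≟ᶜ a ⊕ x) refl
    ... | no  x≢q  = dec-false (a ⊕ x ≟ᶜ a ⊕ q) (x≢q ∘ ⊕-cancelˡ a)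

  ∑-allSubsets-∏-sgn : ∀ L → ∑[ F ← allSubsets ] ∏[ x ← L ] sgn (F x) ≤ #subsets * 𝟙 (does (balanced? L))
  ∑-allSubsets-∏-sgn L with balanced? L
  ... | yes _ = begin
    ∑[ F ← allSubsets ] ∏[ x ← L ] sgn (F x) ≤⟨ ∑-mono-≤ allSubsets (λ {F} _ → ∏-sgn≤1 L F) ⟩
    #subsets                                  ≡⟨ sym (*-identityʳ #subsets) ⟩
    #subsets * 1ℚ                             ∎
    where open ≤-Reasoning
  ... | no ¬bal = begin
    ∑[ F ← allSubsets ] ∏[ x ← L ] sgn (F x) ≡⟨ ∑-subsetsOn-∏-sgn (allCube N) L (∈-allCube q) oddqL ⟩
    0ℚ                                        ≡⟨ sym (*-zeroʳ #subsets) ⟩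
    #subsets * 0ℚ                             ∎
    where
    open ≤-Reasoning
    unbalanced = ¬All⇒Any¬ (λ q → odd q L Bool.≟ false) L ¬bal
    q = proj₁ (Any.satisfied unbalanced)
    oddqL : odd q L ≡ true
    oddqL = Boolₚ.¬-not (proj₂ (Any.satisfied unbalanced))

  tuples : ℕ → List (List (Cube N))
  tuples zero    = [] ∷ []
  tuples (suc m) = cartesianProductWith _∷_ (allCube N) (tuples m)

  ∈-tuples : ∀ ys → ys ∈ tuples (length ys)
  ∈-tuples []       = here refl
  ∈-tuples (y ∷ ys) = ∈-cartesianProductWith⁺ _∷_ (∈-allCube y) (∈-tuples ys)

  ∈-tuples⁻ : ∀ {m ys} → ys ∈ tuples m → length ys ≡ m
  ∈-tuples⁻ {zero}  (here refl) = refl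
  ∈-tuples⁻ {suc m} ys∈ with ∈-cartesianProductWith⁻ _∷_ (allCube N) (tuples m) ys∈
  ... | _ , _ , _ , ys′∈ , refl = cong suc (∈-tuples⁻ ys′∈)

  ∑-tuples-1 : ∀ m → ∑[ _ ← tuples m ] 1ℚ ≡ ℕ→ℚ (2 ℕ.^ N) ^ m
  ∑-tuples-1 zero    = +-identityʳ 1ℚ
  ∑-tuples-1 (suc m) = begin
    ∑[ _ ← tuples (suc m) ] 1ℚ                   ≡⟨ ∑-cartesianProductWith _∷_ (allCube N) (tuples m) (λ _ → 1ℚ) ⟩
    ∑[ _ ← allCube N ] ∑[ _ ← tuples m ] 1ℚ      ≡⟨ ∑-cong (allCube N) (λ _ → ∑-tuples-1 m) ⟩
    ∑[ _ ← allCube N ] (ℕ→ℚ (2 ℕ.^ N) ^ m)       ≡⟨ ∑-allCube-const N (ℕ→ℚ (2 ℕ.^ N) ^ m) ⟩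
    ℕ→ℚ (2 ℕ.^ N) ^ suc m                        ∎
    where open ≡-Reasoning

  shifts : List (Cube N) → List (Cube N) → List (Cube N)
  shifts = cartesianProductWith _⊕_

  corr^≡ : ∀ F S m → corr F S ^ m ≡ ∑[ ys ← tuples m ] ∏[ q ← shifts ys S ] sgn (F q)
  corr^≡ F S zero    = sym (+-identityʳ 1ℚ)
  corr^≡ F S (suc m) = begin
    corr F S * corr F S ^ m
      ≡⟨ cong (corr F S *_) (corr^≡ F S m) ⟩
    corr F S * ∑[ ys ← tuples m ] ∏[ q ← shifts ys S ] sgn (F q)
      ≡⟨ ∑-*-∑ (allCube N) (tuples m) _ _ ⟩
    ∑[ y ← allCube N ] ∑[ ys ← tuples m ] (∏[ x ← S ] sgn (F (y ⊕ x)) * ∏[ q ← shifts ys S ] sgn (F q))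
      ≡⟨ ∑-cong (allCube N) (λ y → ∑-cong (tuples m) (λ ys → sym (∏-shifts-∷ y ys))) ⟩
    ∑[ y ← allCube N ] ∑[ ys ← tuples m ] ∏[ q ← shifts (y ∷ ys) S ] sgn (F q)
      ≡⟨ sym (∑-cartesianProductWith _∷_ (allCube N) (tuples m) (λ ys → ∏[ q ← shifts ys S ] sgn (F q))) ⟩
    ∑[ ys ← tuples (suc m) ] ∏[ q ← shifts ys S ] sgn (F q)
      ∎
    where
    open ≡-Reasoning
    ∏-shifts-∷ : ∀ y ys → ∏[ q ← shifts (y ∷ ys) S ] sgn (F q)
               ≡ ∏[ x ← S ] sgn (F (y ⊕ x)) * ∏[ q ← shifts ys S ] sgn (F q)
    ∏-shifts-∷ y ys = trans (∏-++ (map (y ⊕_) S) (shifts ys S) (sgn ∘ F))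
                            (cong (_* ∏[ q ← shifts ys S ] sgn (F q)) (∏-map (y ⊕_) S (sgn ∘ F)))

  ∑-corr^≤ : ∀ S m → ∑[ F ← allSubsets ] (corr F S ^ m)
                   ≤ #subsets * ∑[ ys ← tuples m ] 𝟙 (does (balanced? (shifts ys S)))
  ∑-corr^≤ S m = begin
    ∑[ F ← allSubsets ] (corr F S ^ m)
      ≡⟨ ∑-cong allSubsets (λ F → corr^≡ F S m) ⟩
    ∑[ F ← allSubsets ] ∑[ ys ← tuples m ] ∏[ q ← shifts ys S ] sgn (F q)
      ≡⟨ ∑-comm allSubsets (tuples m) _ ⟩
    ∑[ ys ← tuples m ] ∑[ F ← allSubsets ] ∏[ q ← shifts ys S ] sgn (F q)
      ≤⟨ ∑-mono-≤ (tuples m) (λ {ys} _ → ∑-allSubsets-∏-sgn (shifts ys S)) ⟩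
    ∑[ ys ← tuples m ] (#subsets * 𝟙 (does (balanced? (shifts ys S))))
      ≡⟨ sym (*-distribˡ-∑ #subsets (tuples m) _) ⟩
    #subsets * ∑[ ys ← tuples m ] 𝟙 (does (balanced? (shifts ys S)))
      ∎
    where open ≤-Reasoning

∈-─ : ∀ {x y : A} {xs} (x∈xs : x ∈ xs) → y ∈ xs → y ≢ x → y ∈ (xs ─ x∈xs)
∈-─ (here refl)  (here refl)  y≢x = ⊥-elim (y≢x refl)
∈-─ (here refl)  (there y∈xs) _   = y∈xs
∈-─ (there x∈xs) (here refl)  _   = here refl
∈-─ (there x∈xs) (there y∈xs) y≢x = there (∈-─ x∈xs y∈xs y≢x)

length-≤-by-partners : ∀ (Partner : A → B → Set) {as : List A} {bs : List B} →
  AllPairs (λ a a′ → ∀ {b} → Partner a b → Partner a′ b → ⊥) as →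
  (∀ {a} → a ∈ as → ∃ λ b → b ∈ bs × Partner a b) →
  length as ℕ.≤ length bs
length-≤-by-partners Partner {[]}     _                  _       = z≤n
length-≤-by-partners Partner {a ∷ as} {bs} (a-excl ∷ excl) partner
  with b , b∈bs , Pab ← partner (here refl) =
  ℕₚ.≤-trans (s≤s (length-≤-by-partners Partner excl partner′))
             (ℕₚ.≤-reflexive (sym (Listₚ.length-removeAt′ bs (Any.index b∈bs))))
  where
  partner′ : ∀ {a′} → a′ ∈ as → ∃ λ b′ → b′ ∈ (bs ─ b∈bs) × Partner a′ b′
  partner′ a′∈as with b′ , b′∈bs , Pa′b′ ← partner (there a′∈as) =
    b′ , ∈-─ b∈bs b′∈bs (λ { refl → All.lookup a-excl a′∈as Pab Pa′b′ }) , Pa′b′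

-- Balanced tuples have few free entries

module Pairing {N : ℕ} (S : List (Cube N)) where

  open import Data.List.Membership.DecPropositional (_≟ᶜ_ {N}) using (_∈?_)

  D : List (Cube N)
  D = cartesianProductWith _⊕_ S S

  D² : List (Cube N)
  D² = cartesianProductWith _⊕_ D D

  Near : Cube N → Cube N → Set
  Near y y′ = y ⊕ y′ ∈ D²

  Free : Cube N → List (Cube N) → Set
  Free y ys = ¬ Any (Near y) ys

  near? : ∀ y y′ → Dec (Near y y′)
  near? y y′ = y ⊕ y′ ∈? D²

  -- Opaque, so that with-abstraction over free? y ys sees the decision rather than its unfolding.
  opaque
    free? : ∀ y ys → Dec (Free y ys)
    free? y ys = ¬? (any? (near? y) ys)

  freeEntries : List (Cube N) → List (Cube N)
  freeEntries []       = []
  freeEntries (y ∷ ys) = if does (free? y ys) then y ∷ freeEntries ys else freeEntries ys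

  nonFreeEntries : List (Cube N) → List (Cube N)
  nonFreeEntries []       = []
  nonFreeEntries (y ∷ ys) = if does (free? y ys) then nonFreeEntries ys else y ∷ nonFreeEntries ys

  nfree : List (Cube N) → ℕ
  nfree = length ∘ freeEntries

  nfree+nnonFree : ∀ ys → nfree ys ℕ.+ length (nonFreeEntries ys) ≡ length ys
  nfree+nnonFree []       = refl
  nfree+nnonFree (y ∷ ys) with free? y ys
  ... | yes _ = cong suc (nfree+nnonFree ys)
  ... | no  _ = trans (ℕₚ.+-suc (nfree ys) _) (cong suc (nfree+nnonFree ys))

  freeEntries-⊆ : ∀ {a} ys → a ∈ freeEntries ys → a ∈ ys
  freeEntries-⊆ (y ∷ ys) a∈ with free? y ys
  freeEntries-⊆ (y ∷ ys) (here refl)  | yes _ = here refl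
  freeEntries-⊆ (y ∷ ys) (there a∈)   | yes _ = there (freeEntries-⊆ ys a∈)
  freeEntries-⊆ (y ∷ ys) a∈           | no  _ = there (freeEntries-⊆ ys a∈)

  freeEntries-far : ∀ ys → AllPairs (λ a a′ → ¬ Near a a′) (freeEntries ys)
  freeEntries-far []       = []
  freeEntries-far (y ∷ ys) with free? y ys
  ... | yes y-free = All.tabulate (λ a′∈ near → y-free (Any.map (λ { refl → near }) (freeEntries-⊆ ys a′∈)))
                     ∷ freeEntries-far ys
  ... | no  _      = freeEntries-far ys

  ∈-freeEntries⁻ : ∀ {a} ys → a ∈ freeEntries ys → ∃₂ λ pre post → ys ≡ pre ++ a ∷ post × Free a post
  ∈-freeEntries⁻ (y ∷ ys) a∈ with free? y ys
  ∈-freeEntries⁻ (y ∷ ys) (here refl) | yes y-free = [] , ys , refl , y-free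
  ∈-freeEntries⁻ (y ∷ ys) (there a∈)  | yes _      with pre , post , refl , a-free ← ∈-freeEntries⁻ ys a∈ =
    y ∷ pre , post , refl , a-free
  ∈-freeEntries⁻ (y ∷ ys) a∈          | no  _      with pre , post , refl , a-free ← ∈-freeEntries⁻ ys a∈ =
    y ∷ pre , post , refl , a-free

  ∈-nonFreeEntries⁺ : ∀ {w} pre rest → Any (Near w) rest → w ∈ nonFreeEntries (pre ++ w ∷ rest)
  ∈-nonFreeEntries⁺ {w} [] rest near with free? w rest
  ... | yes w-free = ⊥-elim (w-free near)
  ... | no  _      = here refl
  ∈-nonFreeEntries⁺ {w} (y ∷ pre) rest near with free? y (pre ++ w ∷ rest)
  ... | yes _ = ∈-nonFreeEntries⁺ pre rest near
  ... | no  _ = there (∈-nonFreeEntries⁺ pre rest near)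

  module _ {x₀} (x₀∈S : x₀ ∈ S) (S-unique : Unique S) where

    D⊆D² : ∀ {d} → d ∈ D → d ∈ D²
    D⊆D² {d} d∈D = subst (_∈ D²) (trans (cong (d ⊕_) (x⊕x≡0 x₀)) (⊕-identityʳ d))
      (∈-cartesianProductWith⁺ _⊕_ d∈D (∈-cartesianProductWith⁺ _⊕_ x₀∈S x₀∈S))

    -- a ⊕ x₀ occurs exactly once in the row a ⊕ S, so balance forces it into a row w ⊕ S of another entry.
    odd-other-rows : ∀ {a} pre post → Balanced (shifts (pre ++ a ∷ post) S) →
                     odd (a ⊕ x₀) (shifts (pre ++ post) S) ≡ true
    odd-other-rows {a} pre post balanced = begin
      odd q (shifts (pre ++ post) S)
        ≡⟨ cong (odd q) (Listₚ.cartesianProductWith-distribʳ-++ _⊕_ pre post S) ⟩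
      odd q (shifts pre S ++ shifts post S)
        ≡⟨ odd-++ q (shifts pre S) (shifts post S) ⟩
      oddPre xor oddPost
        ≡⟨ sym (Boolₚ.not-involutive (oddPre xor oddPost)) ⟩
      not (not (oddPre xor oddPost))
        ≡⟨ cong not (trans (Boolₚ.not-distribʳ-xor oddPre oddPost) (cong (oddPre xor_) (sym (Boolₚ.true-xor oddPost)))) ⟩
      not (oddPre xor (true xor oddPost))
        ≡⟨ cong not (trans (sym odd-all-rows) (All.lookup balanced q∈shifts)) ⟩
      true ∎
      where
      open ≡-Reasoning
      q = a ⊕ x₀
      oddPre = odd q (shifts pre S)
      oddPost = odd q (shifts post S)

      q∈shifts : q ∈ shifts (pre ++ a ∷ post) S
      q∈shifts = ∈-cartesianProductWith⁺ _⊕_ (∈-insert pre) x₀∈S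

      odd-all-rows : odd q (shifts (pre ++ a ∷ post) S) ≡ oddPre xor (true xor oddPost)
      odd-all-rows = begin
        odd q (shifts (pre ++ a ∷ post) S)
          ≡⟨ cong (odd q) (Listₚ.cartesianProductWith-distribʳ-++ _⊕_ pre (a ∷ post) S) ⟩
        odd q (shifts pre S ++ (map (a ⊕_) S ++ shifts post S))
          ≡⟨ trans (odd-++ q (shifts pre S) _) (cong (oddPre xor_) (odd-++ q (map (a ⊕_) S) _)) ⟩
        oddPre xor (odd q (map (a ⊕_) S) xor oddPost)
          ≡⟨ cong (λ c → oddPre xor (c xor oddPost)) (trans (odd-map-⊕ a x₀ S) (odd-Unique S-unique x₀∈S)) ⟩
        oddPre xor (true xor oddPost) ∎

    partner : ∀ {a} pre post → Balanced (shifts (pre ++ a ∷ post) S) → ∃ λ w → w ∈ pre ++ post × a ⊕ w ∈ D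
    partner {a} pre post balanced
      with w , x , w∈ , x∈S , q≡w⊕x ←
             ∈-cartesianProductWith⁻ _⊕_ (pre ++ post) S (odd⇒∈ _ (odd-other-rows pre post balanced)) =
      w , w∈ , subst (_∈ D) (sym a⊕w≡x₀⊕x) (∈-cartesianProductWith⁺ _⊕_ x₀∈S x∈S)
      where
      a⊕w≡x₀⊕x : a ⊕ w ≡ x₀ ⊕ x
      a⊕w≡x₀⊕x = x⊕y≡0⇒x≡y (begin
        (a ⊕ w) ⊕ (x₀ ⊕ x) ≡⟨ ⊕-interchange a w x₀ x ⟩
        (a ⊕ x₀) ⊕ (w ⊕ x) ≡⟨ cong ((a ⊕ x₀) ⊕_) (sym q≡w⊕x) ⟩
        (a ⊕ x₀) ⊕ (a ⊕ x₀) ≡⟨ x⊕x≡0 (a ⊕ x₀) ⟩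
        0ᶜ                 ∎)
        where open ≡-Reasoning

    nonFreePartner : ∀ ys → Balanced (shifts ys S) → ∀ {a} → a ∈ freeEntries ys →
                     ∃ λ v → v ∈ nonFreeEntries ys × a ⊕ v ∈ D
    nonFreePartner ys balanced {a} a∈
      with pre , post , refl , a-free ← ∈-freeEntries⁻ ys a∈
      with w , w∈ , a⊕w∈D ← partner pre post balanced
      with ∈-++⁻ pre w∈
    ... | inj₂ w∈post = ⊥-elim (a-free (Any.map (λ { refl → D⊆D² a⊕w∈D }) w∈post))
    ... | inj₁ w∈pre with pre₁ , pre₂ , refl ← ∈-∃++ w∈pre =
      w , subst (λ zs → w ∈ nonFreeEntries zs) (sym (Listₚ.++-assoc pre₁ (w ∷ pre₂) (a ∷ post)))
                (∈-nonFreeEntries⁺ pre₁ (pre₂ ++ a ∷ post) (Anyₚ.++⁺ʳ pre₂ (here w-near-a)))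
        , a⊕w∈D
      where
      w-near-a : Near w a
      w-near-a = D⊆D² (subst (_∈ D) (⊕-comm a w) a⊕w∈D)

    nfree≤nnonFree : ∀ ys → Balanced (shifts ys S) → nfree ys ℕ.≤ length (nonFreeEntries ys)
    nfree≤nnonFree ys balanced =
      length-≤-by-partners (λ a v → a ⊕ v ∈ D) (AllPairs.map no-shared-partner (freeEntries-far ys))
                           (nonFreePartner ys balanced)
      where
      no-shared-partner : ∀ {a a′} → ¬ Near a a′ → ∀ {v} → a ⊕ v ∈ D → a′ ⊕ v ∈ D → ⊥
      no-shared-partner {a} {a′} far {v} a⊕v∈D a′⊕v∈D = far (subst (_∈ D²) a⊕a′≡ (∈-cartesianProductWith⁺ _⊕_ a⊕v∈D a′⊕v∈D))
        where
        a⊕a′≡ : (a ⊕ v) ⊕ (a′ ⊕ v) ≡ a ⊕ a′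
        a⊕a′≡ = trans (⊕-interchange a v a′ v) (trans (cong ((a ⊕ a′) ⊕_) (x⊕x≡0 v)) (⊕-identityʳ (a ⊕ a′)))

    balanced⇒nfree≤ : ∀ {ys} p → length ys ≡ p ℕ.+ p → Balanced (shifts ys S) → nfree ys ℕ.≤ p
    balanced⇒nfree≤ {ys} p len balanced with ℕₚ.≤-<-connex (nfree ys) p
    ... | inj₁ nfree≤p = nfree≤p
    ... | inj₂ p<nfree = ⊥-elim (ℕₚ.<-irrefl refl (begin-strict
      p ℕ.+ p                                 <⟨ ℕₚ.+-mono-< p<nfree (ℕₚ.<-≤-trans p<nfree (nfree≤nnonFree ys balanced)) ⟩
      nfree ys ℕ.+ length (nonFreeEntries ys) ≡⟨ nfree+nnonFree ys ⟩
      length ys                               ≡⟨ len ⟩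
      p ℕ.+ p                                 ∎))
      where open ℕₚ.≤-Reasoning


  1≤∑δ : ∀ {z : Cube N} {L} → z ∈ L → 1ℚ ≤ ∑[ d ← L ] δ z d
  1≤∑δ {z} z∈L = ≤-trans (≤-reflexive (sym (δ-refl z))) (term≤∑ (δ z) (δ-nonNeg z) z∈L)

  nonFree≤∑δ : ∀ y ys → 𝟙 (not (does (free? y ys))) ≤ ∑[ y′ ← ys ] ∑[ d ← D² ] δ (y ⊕ y′) d
  nonFree≤∑δ y ys with free? y ys
  ... | yes _ = ∑-nonNeg ys (λ y′ → ∑-nonNeg D² (δ-nonNeg (y ⊕ y′)))
  ... | no ¬free with any? (near? y) ys
  ...   | no ¬near = ⊥-elim (¬free ¬near)
  ...   | yes near with y′ , y′∈ys , y⊕y′∈D² ← find near =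
    ≤-trans (1≤∑δ y⊕y′∈D²) (term≤∑ (λ y′ → ∑[ d ← D² ] δ (y ⊕ y′) d)
                                   (λ y′ → ∑-nonNeg D² (δ-nonNeg (y ⊕ y′))) y′∈ys)

  #nonFree≤ : ∀ ys → ∑[ y ← allCube N ] 𝟙 (not (does (free? y ys))) ≤ ℕ→ℚ (length ys ℕ.* length D²)
  #nonFree≤ ys = begin
    ∑[ y ← allCube N ] 𝟙 (not (does (free? y ys)))
      ≤⟨ ∑-mono-≤ (allCube N) (λ {y} _ → nonFree≤∑δ y ys) ⟩
    ∑[ y ← allCube N ] ∑[ y′ ← ys ] ∑[ d ← D² ] δ (y ⊕ y′) d
      ≡⟨ ∑-comm (allCube N) ys _ ⟩
    ∑[ y′ ← ys ] ∑[ y ← allCube N ] ∑[ d ← D² ] δ (y ⊕ y′) d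
      ≡⟨ ∑-cong ys (λ y′ → ∑-comm (allCube N) D² _) ⟩
    ∑[ y′ ← ys ] ∑[ d ← D² ] ∑[ y ← allCube N ] δ (y ⊕ y′) d
      ≡⟨ ∑-cong ys (λ y′ → ∑-cong D² (λ d → trans (∑-cong (allCube N) (λ y → δ-shift y y′ d))
                                                   (∑-δ-allCube (d ⊕ y′)))) ⟩
    ∑[ y′ ← ys ] ∑[ d ← D² ] 1ℚ
      ≡⟨ ∑-cong ys (λ y′ → trans (∑-const D² 1ℚ) (*-identityʳ _)) ⟩
    ∑[ y′ ← ys ] ℕ→ℚ (length D²)
      ≡⟨ ∑-const ys _ ⟩
    ℕ→ℚ (length ys) * ℕ→ℚ (length D²)
      ≡⟨ sym (ℕ→ℚ-* (length ys) (length D²)) ⟩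
    ℕ→ℚ (length ys ℕ.* length D²) ∎
    where open ≤-Reasoning

  count : ℕ → ℕ → ℚ
  count m j = ∑[ ys ← tuples m ] 𝟙 (does (nfree ys ℕ.≤? j))

  module _ (W : ℚ) (M : ℕ) (1≤W : 1ℚ ≤ W) (M|D²|≤W : ℕ→ℚ (M ℕ.* length D²) ≤ W) where

    private
      P = ℕ→ℚ (2 ℕ.^ N)

      1≤P : 1ℚ ≤ P
      1≤P = ℕ→ℚ-mono-≤ (ℕₚ.m^n>0 2 N)

      0≤W : 0ℚ ≤ W
      0≤W = ≤-trans 0≤1 1≤W

    head-step : ∀ ys j → length ys ℕ.≤ M →
      ∑[ y ← allCube N ] 𝟙 (does (nfree (y ∷ ys) ℕ.≤? j))
        ≤ P * 𝟙 (does (suc (nfree ys) ℕ.≤? j)) + W * 𝟙 (does (nfree ys ℕ.≤? j))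
    head-step ys j |ys|≤M = begin
      ∑[ y ← allCube N ] 𝟙 (does (nfree (y ∷ ys) ℕ.≤? j))
        ≤⟨ ∑-mono-≤ (allCube N) (λ {y} _ → split y) ⟩
      ∑[ y ← allCube N ] (a + 𝟙 (not (does (free? y ys))) * b)
        ≡⟨ ∑-distrib-+ (allCube N) (λ _ → a) (λ y → 𝟙 (not (does (free? y ys))) * b) ⟩
      ∑[ y ← allCube N ] a + ∑[ y ← allCube N ] (𝟙 (not (does (free? y ys))) * b)
        ≡⟨ cong₂ _+_ (∑-allCube-const N a) (sym (*-distribʳ-∑ b (allCube N) _)) ⟩
      P * a + (∑[ y ← allCube N ] 𝟙 (not (does (free? y ys)))) * b
        ≤⟨ +-monoʳ-≤ (P * a) (*-monoʳ-≤-nonNeg b {{nonNegative (𝟙-nonNeg (does (nfree ys ℕ.≤? j)))}} #nonFree≤W) ⟩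
      P * a + W * b ∎
      where
      open ≤-Reasoning
      a = 𝟙 (does (suc (nfree ys) ℕ.≤? j))
      b = 𝟙 (does (nfree ys ℕ.≤? j))
      split : ∀ y → 𝟙 (does (nfree (y ∷ ys) ℕ.≤? j)) ≤ a + 𝟙 (not (does (free? y ys))) * b
      split y with free? y ys
      ... | yes _ = ≤-reflexive (sym (trans (cong (a +_) (*-zeroˡ b)) (+-identityʳ a)))
      ... | no  _ = ≤-trans (≤-reflexive (sym (trans (+-identityˡ (1ℚ * b)) (*-identityˡ b))))
                            (+-monoˡ-≤ (1ℚ * b) (𝟙-nonNeg (does (suc (nfree ys) ℕ.≤? j))))
      #nonFree≤W : ∑[ y ← allCube N ] 𝟙 (not (does (free? y ys))) ≤ W
      #nonFree≤W = ≤-trans (#nonFree≤ ys) (≤-trans (ℕ→ℚ-mono-≤ (ℕₚ.*-monoˡ-≤ (length D²) |ys|≤M)) M|D²|≤W)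

    count-step : ∀ m j → m ℕ.≤ M →
      count (suc m) j ≤ P * ∑[ ys ← tuples m ] 𝟙 (does (suc (nfree ys) ℕ.≤? j)) + W * count m j
    count-step m j m≤M = begin
      count (suc m) j
        ≡⟨ ∑-cartesianProductWith _∷_ (allCube N) (tuples m) _ ⟩
      ∑[ y ← allCube N ] ∑[ ys ← tuples m ] 𝟙 (does (nfree (y ∷ ys) ℕ.≤? j))
        ≡⟨ ∑-comm (allCube N) (tuples m) _ ⟩
      ∑[ ys ← tuples m ] ∑[ y ← allCube N ] 𝟙 (does (nfree (y ∷ ys) ℕ.≤? j))
        ≤⟨ ∑-mono-≤ (tuples m) (λ {ys} ys∈ → head-step ys j (subst (ℕ._≤ M) (sym (∈-tuples⁻ ys∈)) m≤M)) ⟩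
      ∑[ ys ← tuples m ] (P * 𝟙 (does (suc (nfree ys) ℕ.≤? j)) + W * 𝟙 (does (nfree ys ℕ.≤? j)))
        ≡⟨ ∑-distrib-+ (tuples m) _ _ ⟩
      ∑[ ys ← tuples m ] (P * 𝟙 (does (suc (nfree ys) ℕ.≤? j))) + ∑[ ys ← tuples m ] (W * 𝟙 (does (nfree ys ℕ.≤? j)))
        ≡⟨ sym (cong₂ _+_ (*-distribˡ-∑ P (tuples m) _) (*-distribˡ-∑ W (tuples m) _)) ⟩
      P * ∑[ ys ← tuples m ] 𝟙 (does (suc (nfree ys) ℕ.≤? j)) + W * count m j ∎
      where open ≤-Reasoning

    -- Each entry of a tuple is either free (P choices) or not (at most W choices), and at most j are free.
    count≤ : ∀ m j → m ℕ.≤ M → count m j ≤ (W + W) ^ m * P ^ j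
    count≤ zero    j _   = begin
      1ℚ + 0ℚ          ≡⟨ +-identityʳ 1ℚ ⟩
      1ℚ               ≤⟨ ^-monoʳ-≤ {i = 0} {j = j} 1≤P z≤n ⟩
      P ^ j            ≡⟨ sym (*-identityˡ (P ^ j)) ⟩
      1ℚ * P ^ j       ∎
      where open ≤-Reasoning
    count≤ (suc m) zero m<M = begin
      count (suc m) 0
        ≤⟨ count-step m 0 m≤M ⟩
      P * ∑[ ys ← tuples m ] 𝟙 (does (suc (nfree ys) ℕ.≤? 0)) + W * count m 0
        ≡⟨ cong (λ z → P * z + W * count m 0)
                (trans (∑-cong (tuples m) (λ ys → cong 𝟙 (dec-false (suc (nfree ys) ℕ.≤? 0) (λ ())))) (∑-zero (tuples m))) ⟩
      P * 0ℚ + W * count m 0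
        ≡⟨ trans (cong (_+ W * count m 0) (*-zeroʳ P)) (+-identityˡ _) ⟩
      W * count m 0
        ≤⟨ *-monoˡ-≤-nonNeg W {{nonNegative 0≤W}} (count≤ m 0 m≤M) ⟩
      W * ((W + W) ^ m * 1ℚ)
        ≤⟨ *-monoʳ-≤-nonNeg ((W + W) ^ m * 1ℚ) {{nonNegative (nonNeg*nonNeg (^-nonNeg m 0≤2W) 0≤1)}}
                             (≤-trans (≤-reflexive (sym (+-identityˡ W))) (+-monoˡ-≤ W 0≤W)) ⟩
      (W + W) * ((W + W) ^ m * 1ℚ)
        ≡⟨ sym (*-assoc (W + W) ((W + W) ^ m) 1ℚ) ⟩
      (W + W) ^ suc m * P ^ 0 ∎
      where
      open ≤-Reasoning
      m≤M = ℕₚ.≤-trans (ℕₚ.n≤1+n m) m<M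
      0≤2W = +-mono-≤ 0≤W 0≤W
    count≤ (suc m) (suc j) m<M = begin
      count (suc m) (suc j)
        ≤⟨ count-step m (suc j) m≤M ⟩
      P * ∑[ ys ← tuples m ] 𝟙 (does (suc (nfree ys) ℕ.≤? suc j)) + W * count m (suc j)
        ≡⟨ cong (λ z → P * z + W * count m (suc j)) (∑-cong (tuples m) (λ ys → cong 𝟙 (≤?-suc (nfree ys) j))) ⟩
      P * count m j + W * count m (suc j)
        ≤⟨ +-mono-≤ (*-monoˡ-≤-nonNeg P {{nonNegative 0≤P}} (count≤ m j m≤M))
                    (*-monoˡ-≤-nonNeg W {{nonNegative 0≤W}} (count≤ m (suc j) m≤M)) ⟩
      P * ((W + W) ^ m * P ^ j) + W * ((W + W) ^ m * P ^ suc j)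
        ≡⟨ solve 4 (λ P W a b → P :* (a :* b) :+ W :* (a :* (P :* b)) := (con 1ℚ :+ W) :* (a :* (P :* b)))
                 refl P W ((W + W) ^ m) (P ^ j) ⟩
      (1ℚ + W) * ((W + W) ^ m * P ^ suc j)
        ≤⟨ *-monoʳ-≤-nonNeg ((W + W) ^ m * P ^ suc j) {{nonNegative (nonNeg*nonNeg (^-nonNeg m 0≤2W) (^-nonNeg (suc j) 0≤P))}}
                            (+-monoˡ-≤ W 1≤W) ⟩
      (W + W) * ((W + W) ^ m * P ^ suc j)
        ≡⟨ sym (*-assoc (W + W) ((W + W) ^ m) (P ^ suc j)) ⟩
      (W + W) ^ suc m * P ^ suc j ∎
      where
      open ≤-Reasoning
      m≤M = ℕₚ.≤-trans (ℕₚ.n≤1+n m) m<M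
      0≤2W = +-mono-≤ 0≤W 0≤W
      0≤P = ≤-trans 0≤1 1≤P

-- Existence of pseudorandom subsets

-- An entry of an m-tuple that is not free lies in ys ⊕ D², a set of size at most m·K⁴ < nonFreeBound m K.
nonFreeBound : ℕ → ℕ → ℕ
nonFreeBound m K = suc (m ℕ.* ((K ℕ.* K) ℕ.* (K ℕ.* K)))

module _ {N : ℕ} where

  open import Data.List.Relation.Unary.Unique.DecPropositional (_≟ᶜ_ {N}) using (unique?)

  Pseudorandom : ℕ → ℚ → Subset N → Set
  Pseudorandom K τ F = ∀ S → Unique S → 1 ℕ.≤ length S → length S ℕ.≤ K → ∣ corr F S ∣ ≤ τ

  shortLists : ℕ → List (List (Cube N))
  shortLists K = concatMap tuples (applyUpTo suc K)

  ∈-shortLists : ∀ {K} S → 1 ℕ.≤ length S → length S ℕ.≤ K → S ∈ shortLists K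
  ∈-shortLists (x ∷ xs) _ |S|≤K =
    ∈-concatMap⁺ tuples (Any.map (λ { refl → ∈-tuples (x ∷ xs) }) (∈-applyUpTo⁺ suc |S|≤K))

  ∑-shortLists-1 : ∀ K → ∑[ _ ← shortLists K ] 1ℚ ≤ ℕ→ℚ K * ℕ→ℚ (2 ℕ.^ N) ^ K
  ∑-shortLists-1 K = begin
    ∑[ _ ← shortLists K ] 1ℚ                    ≡⟨ ∑-concatMap tuples (applyUpTo suc K) (λ _ → 1ℚ) ⟩
    ∑[ s ← applyUpTo suc K ] ∑[ _ ← tuples s ] 1ℚ ≡⟨ ∑-cong (applyUpTo suc K) ∑-tuples-1 ⟩
    ∑[ s ← applyUpTo suc K ] (P ^ s)            ≤⟨ ∑-mono-≤ (applyUpTo suc K) P^s≤P^K ⟩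
    ∑[ s ← applyUpTo suc K ] (P ^ K)            ≡⟨ ∑-const (applyUpTo suc K) (P ^ K) ⟩
    ℕ→ℚ (length (applyUpTo suc K)) * P ^ K      ≡⟨ cong (λ n → ℕ→ℚ n * P ^ K) (Listₚ.length-applyUpTo suc K) ⟩
    ℕ→ℚ K * P ^ K                               ∎
    where
    open ≤-Reasoning
    P = ℕ→ℚ (2 ℕ.^ N)
    P^s≤P^K : ∀ {s} → s ∈ applyUpTo suc K → P ^ s ≤ P ^ K
    P^s≤P^K s∈ with i , i<K , refl ← ∈-applyUpTo⁻ suc s∈ = ^-monoʳ-≤ (ℕ→ℚ-mono-≤ (ℕₚ.m^n>0 2 N)) i<K

  module _ (K p : ℕ) where

    private
      m = p ℕ.+ p
      Wₙ = nonFreeBound m K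
      W = ℕ→ℚ Wₙ
      P = ℕ→ℚ (2 ℕ.^ N)

    #balanced : List (Cube N) → ℚ
    #balanced S = ∑[ ys ← tuples m ] 𝟙 (does (balanced? (shifts ys S)))

    #balanced≤ : ∀ S → Unique S → 1 ℕ.≤ length S → length S ℕ.≤ K → #balanced S ≤ (W + W) ^ m * P ^ p
    #balanced≤ S@(x₀ ∷ _) S-unique _ |S|≤K = begin
      #balanced S   ≤⟨ ∑-mono-≤ (tuples m) (λ {ys} ys∈ → balanced⇒few-free {ys} (∈-tuples⁻ ys∈)) ⟩
      count m p     ≤⟨ count≤ W m (ℕ→ℚ-mono-≤ {1} {Wₙ} (s≤s z≤n)) m|D²|≤W m p ℕₚ.≤-refl ⟩
      (W + W) ^ m * P ^ p ∎
      where
      open ≤-Reasoning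
      open Pairing S
      balanced⇒few-free : ∀ {ys} → length ys ≡ m → 𝟙 (does (balanced? (shifts ys S))) ≤ 𝟙 (does (nfree ys ℕ.≤? p))
      balanced⇒few-free {ys} |ys|≡m with balanced? (shifts ys S)
      ... | no  _        = 𝟙-nonNeg (does (nfree ys ℕ.≤? p))
      ... | yes balanced = ≤-reflexive (cong 𝟙 (sym (dec-true (nfree ys ℕ.≤? p)
                             (balanced⇒nfree≤ (here refl) S-unique {ys} p |ys|≡m balanced))))
      |D²|≤K⁴ : length D² ℕ.≤ (K ℕ.* K) ℕ.* (K ℕ.* K)
      |D²|≤K⁴ = ℕₚ.≤-trans (ℕₚ.≤-reflexive (trans (length-cartesianProductWith _⊕_ D D)
                                                  (cong₂ ℕ._*_ |D|≡ |D|≡)))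
                           (ℕₚ.*-mono-≤ (ℕₚ.*-mono-≤ |S|≤K |S|≤K) (ℕₚ.*-mono-≤ |S|≤K |S|≤K))
        where |D|≡ = length-cartesianProductWith _⊕_ S S
      m|D²|≤W : ℕ→ℚ (m ℕ.* length D²) ≤ W
      m|D²|≤W = ℕ→ℚ-mono-≤ (ℕₚ.≤-trans (ℕₚ.*-monoʳ-≤ m |D²|≤K⁴) (ℕₚ.n≤1+n (m ℕ.* ((K ℕ.* K) ℕ.* (K ℕ.* K)))))

    moment : Subset N → ℚ
    moment F = ∑[ S ← shortLists K ] (𝟙 (does (unique? S)) * corr F S ^ m)

    ∑-moment≤ : ∑[ F ← allSubsets {N} ] moment F ≤ #subsets {N} * (ℕ→ℚ K * P ^ K * ((W + W) ^ m * P ^ p))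
    ∑-moment≤ = begin
      ∑[ F ← allSubsets {N} ] moment F
        ≡⟨ ∑-comm (allSubsets {N}) (shortLists K) _ ⟩
      ∑[ S ← shortLists K ] ∑[ F ← allSubsets {N} ] (𝟙 (does (unique? S)) * corr F S ^ m)
        ≡⟨ ∑-cong (shortLists K) (λ S → sym (*-distribˡ-∑ (𝟙 (does (unique? S))) (allSubsets {N}) _)) ⟩
      ∑[ S ← shortLists K ] (𝟙 (does (unique? S)) * ∑[ F ← allSubsets {N} ] (corr F S ^ m))
        ≤⟨ ∑-mono-≤ (shortLists K) (λ {S} S∈ → uniqueTerm≤ S (short S∈)) ⟩
      ∑[ S ← shortLists K ] (#subsets {N} * bound)
        ≡⟨ sym (*-distribˡ-∑ (#subsets {N}) (shortLists K) (λ _ → bound)) ⟩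
      #subsets {N} * ∑[ S ← shortLists K ] bound
        ≤⟨ *-monoˡ-≤-nonNeg (#subsets {N}) {{nonNegative (<⇒≤ (#subsets-pos {N}))}} ∑bound≤ ⟩
      #subsets {N} * (ℕ→ℚ K * P ^ K * bound) ∎
      where
      open ≤-Reasoning
      bound = (W + W) ^ m * P ^ p
      0≤bound : 0ℚ ≤ bound
      0≤bound = nonNeg*nonNeg (^-nonNeg m (+-mono-≤ (ℕ→ℚ-nonNeg Wₙ) (ℕ→ℚ-nonNeg Wₙ))) (^-nonNeg p (ℕ→ℚ-nonNeg (2 ℕ.^ N)))
      short : ∀ {S} → S ∈ shortLists K → 1 ℕ.≤ length S × length S ℕ.≤ K
      short {S} S∈ with s , s∈ , S∈tuples ← find (∈-concatMap⁻ tuples {xs = applyUpTo suc K} S∈)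
                   with i , i<K , refl ← ∈-applyUpTo⁻ suc s∈
                   rewrite ∈-tuples⁻ S∈tuples = s≤s z≤n , i<K
      uniqueTerm≤ : ∀ S → 1 ℕ.≤ length S × length S ℕ.≤ K →
        𝟙 (does (unique? S)) * ∑[ F ← allSubsets {N} ] (corr F S ^ m) ≤ #subsets {N} * bound
      uniqueTerm≤ S (1≤|S| , |S|≤K) with unique? S
      ... | no  _ = ≤-trans (≤-reflexive (*-zeroˡ (∑[ F ← allSubsets {N} ] (corr F S ^ m))))
                            (nonNeg*nonNeg (<⇒≤ (#subsets-pos {N})) 0≤bound)
      ... | yes S-unique = begin
        1ℚ * ∑[ F ← allSubsets {N} ] (corr F S ^ m) ≡⟨ *-identityˡ (∑[ F ← allSubsets {N} ] (corr F S ^ m)) ⟩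
        ∑[ F ← allSubsets {N} ] (corr F S ^ m)      ≤⟨ ∑-corr^≤ S m ⟩
        #subsets {N} * #balanced S                  ≤⟨ *-monoˡ-≤-nonNeg (#subsets {N}) {{nonNegative (<⇒≤ (#subsets-pos {N}))}}
                                                                     (#balanced≤ S S-unique 1≤|S| |S|≤K) ⟩
        #subsets {N} * bound                            ∎
      ∑bound≤ : ∑[ S ← shortLists K ] bound ≤ ℕ→ℚ K * P ^ K * bound
      ∑bound≤ = begin
        ∑[ S ← shortLists K ] bound          ≡⟨ ∑-cong (shortLists K) (λ _ → sym (*-identityˡ bound)) ⟩
        ∑[ S ← shortLists K ] (1ℚ * bound)   ≡⟨ sym (*-distribʳ-∑ bound (shortLists K) (λ _ → 1ℚ)) ⟩
        ∑[ S ← shortLists K ] 1ℚ * bound     ≤⟨ *-monoʳ-≤-nonNeg bound {{nonNegative 0≤bound}} (∑-shortLists-1 K) ⟩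
        ℕ→ℚ K * P ^ K * bound                ∎

    ∑moment<∑ : ∀ θ → ℕ→ℚ K * P ^ K * ((W + W) ^ m * P ^ p) < θ →
                ∑[ F ← allSubsets {N} ] moment F < ∑[ F ← allSubsets {N} ] θ
    ∑moment<∑ θ bound<θ = begin-strict
      ∑[ F ← allSubsets {N} ] moment F                        ≤⟨ ∑-moment≤ ⟩
      #subsets {N} * (ℕ→ℚ K * P ^ K * ((W + W) ^ m * P ^ p))  <⟨ *-monoʳ-<-pos (#subsets {N}) {{positive (#subsets-pos {N})}} bound<θ ⟩
      #subsets {N} * θ                                        ≡⟨ *-distribʳ-∑ θ (allSubsets {N}) (λ _ → 1ℚ) ⟩
      ∑[ F ← allSubsets {N} ] (1ℚ * θ)                        ≡⟨ ∑-cong (allSubsets {N}) (λ _ → *-identityˡ θ) ⟩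
      ∑[ F ← allSubsets {N} ] θ                               ∎
      where open ≤-Reasoning

    small-moment⇒pseudorandom : ∀ τ → 0ℚ ≤ τ → ℕ→ℚ K * P ^ K * ((W + W) ^ m * P ^ p) < τ ^ m →
                          ∃ λ F → Pseudorandom K τ F
    small-moment⇒pseudorandom τ 0≤τ bound<τ^m = F , correlation≤
      where
      witness = ∑<∑⇒∃< (allSubsets {N}) (∑moment<∑ (τ ^ m) bound<τ^m)
      F = proj₁ witness
      moment<τ^m : moment F < τ ^ m
      moment<τ^m = proj₂ (proj₂ witness)
      correlation≤ : Pseudorandom K τ F
      correlation≤ S S-unique 1≤|S| |S|≤K = ≮⇒≥ (λ τ<∣corr∣ → <-irrefl refl (begin-strict
        τ ^ m                                ≤⟨ ^-even-mono p 0≤τ (<⇒≤ τ<∣corr∣) ⟩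
        corr F S ^ m                         ≡⟨ sym (*-identityˡ (corr F S ^ m)) ⟩
        1ℚ * corr F S ^ m                    ≡⟨ cong (λ b → 𝟙 b * corr F S ^ m) (sym (dec-true (unique? S) S-unique)) ⟩
        𝟙 (does (unique? S)) * corr F S ^ m  ≤⟨ term≤∑ (λ S → 𝟙 (does (unique? S)) * corr F S ^ m)
                                                      (λ S → nonNeg*nonNeg (𝟙-nonNeg (does (unique? S))) (^-even-nonNeg (corr F S) p))
                                                      (∈-shortLists S 1≤|S| |S|≤K) ⟩
        moment F                             <⟨ moment<τ^m ⟩
        τ ^ m                                ∎))
        where open ≤-Reasoning

nonemptySublists : List A → List (List A)
nonemptySublists []       = []
nonemptySublists (x ∷ xs) = (x ∷ []) ∷ (map (x ∷_) (nonemptySublists xs) ++ nonemptySublists xs)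

nonemptySublists-⊆ : ∀ (xs : List A) → All (λ sub → sub ⊆ xs × 1 ℕ.≤ length sub) (nonemptySublists xs)
nonemptySublists-⊆ []       = []
nonemptySublists-⊆ (x ∷ xs) = (refl ∷ minimum xs , s≤s z≤n)
  ∷ Allₚ.++⁺ (Allₚ.map⁺ (All.map (λ (sub⊆xs , _) → refl ∷ sub⊆xs , s≤s z≤n) (nonemptySublists-⊆ xs)))
             (All.map (λ (sub⊆xs , 1≤|sub|) → x ∷ʳ sub⊆xs , 1≤|sub|) (nonemptySublists-⊆ xs))

length-nonemptySublists : ∀ (xs : List A) → suc (length (nonemptySublists xs)) ≡ 2 ℕ.^ length xs
length-nonemptySublists []       = refl
length-nonemptySublists (x ∷ xs) = begin
  suc (suc (length (map (x ∷_) subs ++ subs)))   ≡⟨ cong (suc ∘ suc) (Listₚ.length-++ (map (x ∷_) subs)) ⟩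
  suc (suc (length (map (x ∷_) subs) ℕ.+ length subs)) ≡⟨ cong (λ n → suc (suc (n ℕ.+ length subs))) (Listₚ.length-map (x ∷_) subs) ⟩
  suc (suc (length subs ℕ.+ length subs))        ≡⟨ cong suc (sym (ℕₚ.+-suc (length subs) (length subs))) ⟩
  suc (length subs) ℕ.+ suc (length subs)        ≡⟨ cong₂ ℕ._+_ (length-nonemptySublists xs) (trans (length-nonemptySublists xs) (sym (ℕₚ.+-identityʳ _))) ⟩
  2 ℕ.^ length (x ∷ xs)                          ∎
  where
  open ≡-Reasoning
  subs = nonemptySublists xs

∈-resp-⊆ : ∀ {x : A} {xs ys} → xs ⊆ ys → x ∈ xs → x ∈ ys
∈-resp-⊆ (y ∷ʳ xs⊆ys)   x∈xs         = there (∈-resp-⊆ xs⊆ys x∈xs)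
∈-resp-⊆ (refl ∷ xs⊆ys) (here refl)  = here refl
∈-resp-⊆ (refl ∷ xs⊆ys) (there x∈xs) = there (∈-resp-⊆ xs⊆ys x∈xs)

Unique-resp-⊇ : ∀ {xs ys : List A} → xs ⊆ ys → Unique ys → Unique xs
Unique-resp-⊇ []              _            = []
Unique-resp-⊇ (y ∷ʳ xs⊆ys)   (_ ∷ uys)    = Unique-resp-⊇ xs⊆ys uys
Unique-resp-⊇ (refl ∷ xs⊆ys) (y≢ys ∷ uys) =
  All.tabulate (All.lookup y≢ys ∘ ∈-resp-⊆ xs⊆ys) ∷ Unique-resp-⊇ xs⊆ys uys

∏-1+≡1+∑∏ : ∀ (v : A → ℚ) xs → ∏[ x ← xs ] (1ℚ + v x) ≡ 1ℚ + ∑[ sub ← nonemptySublists xs ] ∏ sub v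
∏-1+≡1+∑∏ v []       = refl
∏-1+≡1+∑∏ v (x ∷ xs) = begin
  (1ℚ + v x) * ∏[ x ← xs ] (1ℚ + v x)
    ≡⟨ cong ((1ℚ + v x) *_) (∏-1+≡1+∑∏ v xs) ⟩
  (1ℚ + v x) * (1ℚ + Σsubs)
    ≡⟨ solve 2 (λ a c → (con 1ℚ :+ a) :* (con 1ℚ :+ c) := con 1ℚ :+ (a :* con 1ℚ :+ (a :* c :+ c))) refl (v x) Σsubs ⟩
  1ℚ + (v x * 1ℚ + (v x * Σsubs + Σsubs))
    ≡⟨ cong (λ z → 1ℚ + (v x * 1ℚ + (z + Σsubs)))
            (trans (*-distribˡ-∑ (v x) subs (λ sub → ∏ sub v)) (sym (∑-map (x ∷_) subs (λ sub → ∏ sub v)))) ⟩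
  1ℚ + (v x * 1ℚ + (∑[ sub ← map (x ∷_) subs ] ∏ sub v + Σsubs))
    ≡⟨ cong (λ z → 1ℚ + (v x * 1ℚ + z)) (sym (∑-++ (map (x ∷_) subs) subs (λ sub → ∏ sub v))) ⟩
  1ℚ + ∑[ sub ← nonemptySublists (x ∷ xs) ] ∏ sub v ∎
  where
  open ≡-Reasoning
  subs = nonemptySublists xs
  Σsubs = ∑[ sub ← subs ] ∏ sub v

∏-*-const : ∀ c (w : A → ℚ) xs → ∏[ x ← xs ] (c * w x) ≡ c ^ length xs * ∏ xs w
∏-*-const c w []       = sym (*-identityˡ 1ℚ)
∏-*-const c w (x ∷ xs) = trans (cong (c * w x *_) (∏-*-const c w xs))
  (solve 4 (λ c a b d → (c :* a) :* (b :* d) := (c :* b) :* (a :* d)) refl c (w x) (c ^ length xs) (∏ xs w))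

allL-if≡allL-filter : ∀ (X g : A → Bool) L →
  allL (λ x → if X x then g x else true) L ≡ allL g (filter (λ x → X x Bool.≟ true) L)
allL-if≡allL-filter X g []      = refl
allL-if≡allL-filter X g (x ∷ L) with X x
... | false = allL-if≡allL-filter X g L
... | true with g x
...   | true  = allL-if≡allL-filter X g L
...   | false = refl

𝟙-allL : ∀ (g : A → Bool) L → 𝟙 (allL g L) ≡ ∏[ x ← L ] 𝟙 (g x)
𝟙-allL g []      = refl
𝟙-allL g (x ∷ L) with g x
... | true  = trans (𝟙-allL g L) (sym (*-identityˡ (∏[ x ← L ] 𝟙 (g x))))
... | false = sym (*-zeroˡ (∏[ x ← L ] 𝟙 (g x)))

-- Intersections of translates

module _ {N : ℕ} (F : Subset N) where

  private
    P = ℕ→ℚ (2 ℕ.^ N)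

  card⋂translates : ∀ X → ℕ→ℚ (card (⋂translates F X))
    ≡ inv2^ (card X) * (P + ∑[ sub ← nonemptySublists (filter (λ x → X x Bool.≟ true) (allCube N)) ] corr F sub)
  card⋂translates X = begin
    ℕ→ℚ (card (⋂translates F X))
      ≡⟨ length-filter≡∑𝟙 (⋂translates F X) (allCube N) ⟩
    ∑[ y ← allCube N ] 𝟙 (⋂translates F X y)
      ≡⟨ ∑-cong (allCube N) indicator ⟩
    ∑[ y ← allCube N ] (inv2^ (card X) * (1ℚ + ∑[ sub ← subs ] ∏[ x ← sub ] sgn (F (y ⊕ x))))
      ≡⟨ sym (*-distribˡ-∑ (inv2^ (card X)) (allCube N) _) ⟩
    inv2^ (card X) * ∑[ y ← allCube N ] (1ℚ + ∑[ sub ← subs ] ∏[ x ← sub ] sgn (F (y ⊕ x)))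
      ≡⟨ cong (inv2^ (card X) *_) (trans (∑-distrib-+ (allCube N) (λ _ → 1ℚ) _)
              (cong₂ _+_ (trans (∑-allCube-const N 1ℚ) (*-identityʳ P)) (∑-comm (allCube N) subs _))) ⟩
    inv2^ (card X) * (P + ∑[ sub ← subs ] corr F sub) ∎
    where
    open ≡-Reasoning
    xs = filter (λ x → X x Bool.≟ true) (allCube N)
    subs = nonemptySublists xs
    indicator : ∀ y → 𝟙 (⋂translates F X y) ≡ inv2^ (card X) * (1ℚ + ∑[ sub ← subs ] ∏[ x ← sub ] sgn (F (y ⊕ x)))
    indicator y = begin
      𝟙 (⋂translates F X y)                         ≡⟨ cong 𝟙 (allL-if≡allL-filter X (λ x → F (y ⊕ x)) (allCube N)) ⟩
      𝟙 (allL (λ x → F (y ⊕ x)) xs)                 ≡⟨ 𝟙-allL (λ x → F (y ⊕ x)) xs ⟩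
      ∏[ x ← xs ] 𝟙 (F (y ⊕ x))                     ≡⟨ ∏-cong xs (λ x → 𝟙≡½[1+sgn] (F (y ⊕ x))) ⟩
      ∏[ x ← xs ] (½ * (1ℚ + sgn (F (y ⊕ x))))      ≡⟨ ∏-*-const ½ (λ x → 1ℚ + sgn (F (y ⊕ x))) xs ⟩
      ½ ^ card X * ∏[ x ← xs ] (1ℚ + sgn (F (y ⊕ x))) ≡⟨ cong₂ _*_ (sym (inv2^≡½^ (card X))) (∏-1+≡1+∑∏ (λ x → sgn (F (y ⊕ x))) xs) ⟩
      inv2^ (card X) * (1ℚ + ∑[ sub ← subs ] ∏[ x ← sub ] sgn (F (y ⊕ x))) ∎

  intersection-deviation : ∀ X → ℕ→ℚ (card (⋂translates F X)) * inv2^ N - inv2^ (card X)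
    ≡ inv2^ (card X) * inv2^ N * ∑[ sub ← nonemptySublists (filter (λ x → X x Bool.≟ true) (allCube N)) ] corr F sub
  intersection-deviation X = begin
    ℕ→ℚ (card (⋂translates F X)) * I - α   ≡⟨ cong (λ c → c * I - α) (card⋂translates X) ⟩
    α * (P + Σcorr) * I - α                ≡⟨ solve 4 (λ a p s i → a :* (p :+ s) :* i :- a := a :* (p :* i :- con 1ℚ) :+ a :* i :* s)
                                                       refl α P Σcorr I ⟩
    α * (P * I - 1ℚ) + α * I * Σcorr       ≡⟨ cong (λ z → α * (z - 1ℚ) + α * I * Σcorr) (trans (*-comm P I) (inv2^*2^ N)) ⟩
    α * (1ℚ - 1ℚ) + α * I * Σcorr          ≡⟨ solve 2 (λ a b → a :* (con 1ℚ :- con 1ℚ) :+ b := b) refl α (α * I * Σcorr) ⟩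
    α * I * Σcorr                          ∎
    where
    open ≡-Reasoning
    I = inv2^ N
    α = inv2^ (card X)
    Σcorr = ∑[ sub ← nonemptySublists (filter (λ x → X x Bool.≟ true) (allCube N)) ] corr F sub

  pseudorandom⇒intersections : ∀ {K τ} → 0ℚ ≤ τ → Pseudorandom K τ F → ∀ X → card X ℕ.≤ K →
    ∣ ℕ→ℚ (card (⋂translates F X)) * inv2^ N - inv2^ (card X) ∣ ≤ τ * inv2^ N
  pseudorandom⇒intersections {K} {τ} 0≤τ pseudorandom X |X|≤K = begin
    ∣ ℕ→ℚ (card (⋂translates F X)) * I - α ∣
      ≡⟨ cong ∣_∣ (intersection-deviation X) ⟩
    ∣ α * I * Σcorr ∣
      ≡⟨ trans (∣p*q∣≡∣p∣*∣q∣ (α * I) Σcorr) (cong (_* ∣ Σcorr ∣) (0≤p⇒∣p∣≡p 0≤AI)) ⟩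
    α * I * ∣ Σcorr ∣
      ≤⟨ *-monoˡ-≤-nonNeg (α * I) {{nonNegative 0≤AI}} ∣Σcorr∣≤ ⟩
    α * I * (ℕ→ℚ (length subs) * τ)
      ≡⟨ solve 4 (λ a i l t → (a :* i) :* (l :* t) := (a :* l) :* (t :* i)) refl α I (ℕ→ℚ (length subs)) τ ⟩
    α * ℕ→ℚ (length subs) * (τ * I)
      ≤⟨ *-monoʳ-≤-nonNeg (τ * I) {{nonNegative (nonNeg*nonNeg 0≤τ (inv2^-nonNeg N))}} α*#subs≤1 ⟩
    1ℚ * (τ * I)
      ≡⟨ *-identityˡ (τ * I) ⟩
    τ * I ∎
    where
    open ≤-Reasoning
    I = inv2^ N
    α = inv2^ (card X)
    xs = filter (λ x → X x Bool.≟ true) (allCube N)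
    subs = nonemptySublists xs
    Σcorr = ∑[ sub ← subs ] corr F sub
    0≤AI : 0ℚ ≤ α * I
    0≤AI = nonNeg*nonNeg (inv2^-nonNeg (card X)) (inv2^-nonNeg N)
    ∣Σcorr∣≤ : ∣ Σcorr ∣ ≤ ℕ→ℚ (length subs) * τ
    ∣Σcorr∣≤ = begin
      ∣ Σcorr ∣                          ≤⟨ ∣∑∣≤∑∣∣ subs (corr F) ⟩
      ∑[ sub ← subs ] ∣ corr F sub ∣     ≤⟨ ∑-mono-≤ subs (λ sub∈ → bounded (All.lookup (nonemptySublists-⊆ xs) sub∈)) ⟩
      ∑[ sub ← subs ] τ                  ≡⟨ ∑-const subs τ ⟩
      ℕ→ℚ (length subs) * τ              ∎
      where
      bounded : ∀ {sub} → sub ⊆ xs × 1 ℕ.≤ length sub → ∣ corr F sub ∣ ≤ τ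
      bounded (sub⊆xs , 1≤|sub|) = pseudorandom _
        (Unique-resp-⊇ sub⊆xs (Uniqueₚ.filter⁺ (λ x → X x Bool.≟ true) (allCube-Unique N)))
        1≤|sub| (ℕₚ.≤-trans (Sublistₚ.length-mono-≤ sub⊆xs) |X|≤K)

    α*#subs≤1 : α * ℕ→ℚ (length subs) ≤ 1ℚ
    α*#subs≤1 = begin
      α * ℕ→ℚ (length subs)                  ≤⟨ *-monoˡ-≤-nonNeg α {{nonNegative (inv2^-nonNeg (card X))}}
                                                                 (ℕ→ℚ-mono-≤ (ℕₚ.n≤1+n (length subs))) ⟩
      α * ℕ→ℚ (suc (length subs))            ≡⟨ cong (λ n → α * ℕ→ℚ n) (length-nonemptySublists xs) ⟩
      α * ℕ→ℚ (2 ℕ.^ card X)                 ≡⟨ inv2^*2^ (card X) ⟩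
      1ℚ                                     ∎

-- Distributions over translates

sumOver≡∑ : ∀ {N} (B : Subset N) (m : Cube N → ℚ) → sumOver B m ≡ ∑[ t ← allCube N ] (𝟙 (B t) * m t)
sumOver≡∑ {N} B m = go (allCube N)
  where
  go : ∀ ts → List.foldr (λ t acc → (if B t then m t else 0ℚ) + acc) 0ℚ ts ≡ ∑[ t ← ts ] (𝟙 (B t) * m t)
  go []       = refl
  go (t ∷ ts) with B t
  ... | true  = cong₂ _+_ (sym (*-identityˡ (m t))) (go ts)
  ... | false = cong₂ _+_ (sym (*-zeroˡ (m t))) (go ts)

mass≡∑ : ∀ {N} (m : Cube N → ℚ) → mass m ≡ ∑ (allCube N) m
mass≡∑ {N} m = trans (sumOver≡∑ (λ _ → true) m) (∑-cong (allCube N) (λ t → *-identityˡ (m t)))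

markov : ∀ (xs : List A) (g : A → ℚ) {c} → 0ℚ ≤ c →
  ∑[ x ← xs ] (𝟙 (not (does (∣ g x ∣ <? c))) * (c * c)) ≤ ∑[ x ← xs ] (g x * g x)
markov xs g {c} 0≤c = ∑-mono-≤ xs (λ {x} _ → pointwise x)
  where
  pointwise : ∀ x → 𝟙 (not (does (∣ g x ∣ <? c))) * (c * c) ≤ g x * g x
  pointwise x = by-cases (∣ g x ∣ <? c)
    where
    by-cases : (d : Dec (∣ g x ∣ < c)) → 𝟙 (not (does d)) * (c * c) ≤ g x * g x
    by-cases (yes _)     = ≤-trans (≤-reflexive (*-zeroˡ (c * c))) (x*x-nonNeg (g x))
    by-cases (no ∣g∣≮c) = begin
      1ℚ * (c * c)         ≡⟨ *-identityˡ (c * c) ⟩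
      c * c                ≤⟨ *-mono-≤-nonNeg 0≤c 0≤c (≮⇒≥ ∣g∣≮c) (≮⇒≥ ∣g∣≮c) ⟩
      ∣ g x ∣ * ∣ g x ∣    ≡⟨ sym (x*x≡∣x∣*∣x∣ (g x)) ⟩
      g x * g x            ∎
      where open ≤-Reasoning

module _ {N : ℕ} (F : Subset N) (m : Cube N → ℚ) where

  private
    P = ℕ→ℚ (2 ℕ.^ N)
    I = inv2^ N
    σ : Cube N → Cube N → ℚ
    σ t s = sgn (F (t ⊕ s))

  bias : Cube N → ℚ
  bias s = ∑[ t ← allCube N ] (m t * σ t s)

  sumOver-translate : ∀ s → sumOver (translate F s) m - mass m * ½ ≡ ½ * bias s
  sumOver-translate s = begin
    sumOver (translate F s) m - mass m * ½
      ≡⟨ cong₂ (λ a b → a - b * ½) (sumOver≡∑ (translate F s) m) (mass≡∑ m) ⟩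
    ∑[ t ← allCube N ] (𝟙 (F (t ⊕ s)) * m t) - M * ½
      ≡⟨ cong (_- M * ½) (∑-cong (allCube N) (λ t → cong (_* m t) (𝟙≡½[1+sgn] (F (t ⊕ s))))) ⟩
    ∑[ t ← allCube N ] (½ * (1ℚ + σ t s) * m t) - M * ½
      ≡⟨ cong (_- M * ½) (∑-cong (allCube N) (λ t → solve 3 (λ h a b → (h :* (con 1ℚ :+ a)) :* b := h :* b :+ h :* (b :* a))
                                                             refl ½ (σ t s) (m t))) ⟩
    ∑[ t ← allCube N ] (½ * m t + ½ * (m t * σ t s)) - M * ½
      ≡⟨ cong (_- M * ½) (trans (∑-distrib-+ (allCube N) (λ t → ½ * m t) (λ t → ½ * (m t * σ t s)))
             (sym (cong₂ _+_ (*-distribˡ-∑ ½ (allCube N) m) (*-distribˡ-∑ ½ (allCube N) (λ t → m t * σ t s))))) ⟩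
    ½ * M + ½ * bias s - M * ½
      ≡⟨ solve 2 (λ a g → con ½ :* a :+ con ½ :* g :- a :* con ½ := con ½ :* g) refl M (bias s) ⟩
    ½ * bias s ∎
    where
    open ≡-Reasoning
    M = ∑ (allCube N) m

  ∑bias²≡ : ∑[ s ← allCube N ] (bias s * bias s)
          ≡ ∑[ t ← allCube N ] ∑[ t′ ← allCube N ] (m t * m t′ * ∑[ s ← allCube N ] (σ t s * σ t′ s))
  ∑bias²≡ = begin
    ∑[ s ← allCube N ] (bias s * bias s)
      ≡⟨ ∑-cong (allCube N) (λ s → ∑-*-∑ (allCube N) (allCube N) (λ t → m t * σ t s) (λ t′ → m t′ * σ t′ s)) ⟩
    ∑[ s ← allCube N ] ∑[ t ← allCube N ] ∑[ t′ ← allCube N ] (m t * σ t s * (m t′ * σ t′ s))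
      ≡⟨ ∑-comm (allCube N) (allCube N) _ ⟩
    ∑[ t ← allCube N ] ∑[ s ← allCube N ] ∑[ t′ ← allCube N ] (m t * σ t s * (m t′ * σ t′ s))
      ≡⟨ ∑-cong (allCube N) (λ t → ∑-comm (allCube N) (allCube N) _) ⟩
    ∑[ t ← allCube N ] ∑[ t′ ← allCube N ] ∑[ s ← allCube N ] (m t * σ t s * (m t′ * σ t′ s))
      ≡⟨ ∑-cong (allCube N) (λ t → ∑-cong (allCube N) (λ t′ → trans
           (∑-cong (allCube N) (λ s → solve 4 (λ a b c d → (a :* c) :* (b :* d) := (a :* b) :* (c :* d)) refl (m t) (m t′) (σ t s) (σ t′ s)))
           (sym (*-distribˡ-∑ (m t * m t′) (allCube N) (λ s → σ t s * σ t′ s))))) ⟩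
    ∑[ t ← allCube N ] ∑[ t′ ← allCube N ] (m t * m t′ * ∑[ s ← allCube N ] (σ t s * σ t′ s)) ∎
    where open ≡-Reasoning

  module _ {K τ} (0≤τ : 0ℚ ≤ τ) (2≤K : 2 ℕ.≤ K) (pseudorandom : Pseudorandom K τ F)
           (distribution : ∀ x → (0ℚ ≤ m x) × (m x ≤ inv2^ N)) where

    private
      M = ∑ (allCube N) m

      0≤m : ∀ t → 0ℚ ≤ m t
      0≤m = proj₁ ∘ distribution

      0≤M : 0ℚ ≤ M
      0≤M = ∑-nonNeg (allCube N) 0≤m

      M≤1 : M ≤ 1ℚ
      M≤1 = begin
        M                        ≤⟨ ∑-mono-≤ (allCube N) (λ {t} _ → proj₂ (distribution t)) ⟩
        ∑[ _ ← allCube N ] I     ≡⟨ ∑-allCube-const N I ⟩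
        P * I                    ≡⟨ trans (*-comm P I) (inv2^*2^ N) ⟩
        1ℚ                       ∎
        where open ≤-Reasoning

    -- Off the diagonal, ∑ₛ σ t s σ t′ s is a correlation of F with the pair [t, t′].
    ∑σσ≤ : ∀ t t′ → ∑[ s ← allCube N ] (σ t s * σ t′ s) ≤ δ t′ t * P + τ
    ∑σσ≤ t t′ with t′ ≟ᶜ t
    ... | yes refl = begin
      ∑[ s ← allCube N ] (σ t s * σ t s)  ≡⟨ ∑-cong (allCube N) (λ s → sgn*sgn (F (t ⊕ s))) ⟩
      ∑[ s ← allCube N ] 1ℚ               ≡⟨ trans (∑-allCube-const N 1ℚ) (sym (*-comm 1ℚ P)) ⟩
      1ℚ * P                              ≤⟨ ≤-trans (≤-reflexive (sym (+-identityʳ (1ℚ * P)))) (+-monoʳ-≤ (1ℚ * P) 0≤τ) ⟩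
      1ℚ * P + τ                          ∎
      where open ≤-Reasoning
    ... | no t′≢t = begin
      ∑[ s ← allCube N ] (σ t s * σ t′ s)           ≡⟨ ∑-cong (allCube N) (λ s → cong₂ (λ a b → sgn (F a) * b)
                                                        (⊕-comm t s) (trans (cong (sgn ∘ F) (⊕-comm t′ s)) (sym (*-identityʳ (sgn (F (s ⊕ t′))))))) ⟩
      corr F (t ∷ t′ ∷ [])                          ≤⟨ p≤∣p∣ _ ⟩
      ∣ corr F (t ∷ t′ ∷ []) ∣                      ≤⟨ pseudorandom (t ∷ t′ ∷ []) pair-unique (s≤s z≤n) 2≤K ⟩
      τ                                             ≡⟨ sym (trans (cong (_+ τ) (*-zeroˡ P)) (+-identityˡ τ)) ⟩
      0ℚ * P + τ                                    ∎
      where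
      open ≤-Reasoning
      pair-unique : Unique (t ∷ t′ ∷ [])
      pair-unique = ((λ t≡t′ → t′≢t (sym t≡t′)) ∷ []) ∷ [] ∷ []

    ∑∑mm[δP+τ]≡ : ∑[ t ← allCube N ] ∑[ t′ ← allCube N ] (m t * m t′ * (δ t′ t * P + τ))
                 ≡ ∑[ t ← allCube N ] (m t * P * m t) + τ * (M * M)
    ∑∑mm[δP+τ]≡ = trans (∑-cong (allCube N) row) (trans (∑-distrib-+ (allCube N) (λ t → m t * P * m t) (λ t → τ * (m t * M)))
      (cong (∑[ t ← allCube N ] (m t * P * m t) +_)
            (trans (sym (*-distribˡ-∑ τ (allCube N) (λ t → m t * M)))
                   (cong (τ *_) (sym (*-distribʳ-∑ M (allCube N) m))))))
      where
      open ≡-Reasoning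
      row : ∀ t → ∑[ t′ ← allCube N ] (m t * m t′ * (δ t′ t * P + τ)) ≡ m t * P * m t + τ * (m t * M)
      row t = begin
        ∑[ t′ ← allCube N ] (m t * m t′ * (δ t′ t * P + τ))
          ≡⟨ ∑-cong (allCube N) (λ t′ → solve 5 (λ a b d p τ → (a :* b) :* (d :* p :+ τ) := (a :* p) :* (b :* d) :+ τ :* (a :* b))
                                              refl (m t) (m t′) (δ t′ t) P τ) ⟩
        ∑[ t′ ← allCube N ] (m t * P * (m t′ * δ t′ t) + τ * (m t * m t′))
          ≡⟨ ∑-distrib-+ (allCube N) _ _ ⟩
        ∑[ t′ ← allCube N ] (m t * P * (m t′ * δ t′ t)) + ∑[ t′ ← allCube N ] (τ * (m t * m t′))
          ≡⟨ sym (cong₂ _+_ (*-distribˡ-∑ (m t * P) (allCube N) _) (*-distribˡ-∑ τ (allCube N) _)) ⟩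
        m t * P * ∑[ t′ ← allCube N ] (m t′ * δ t′ t) + τ * ∑[ t′ ← allCube N ] (m t * m t′)
          ≡⟨ cong₂ (λ a b → m t * P * a + τ * b) (∑-sift m t) (sym (*-distribˡ-∑ (m t) (allCube N) m)) ⟩
        m t * P * m t + τ * (m t * M) ∎

    ∑mPm≤1 : ∑[ t ← allCube N ] (m t * P * m t) ≤ 1ℚ
    ∑mPm≤1 = begin
      ∑[ t ← allCube N ] (m t * P * m t)  ≤⟨ ∑-mono-≤ (allCube N) (λ {t} _ →
                                               *-monoˡ-≤-nonNeg (m t * P) {{nonNegative (nonNeg*nonNeg (0≤m t) (ℕ→ℚ-nonNeg (2 ℕ.^ N)))}}
                                                                (proj₂ (distribution t))) ⟩
      ∑[ t ← allCube N ] (m t * P * I)    ≡⟨ ∑-cong (allCube N) (λ t → trans (*-assoc (m t) P I) (cong (m t *_) (trans (*-comm P I) (inv2^*2^ N)))) ⟩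
      ∑[ t ← allCube N ] (m t * 1ℚ)       ≡⟨ ∑-cong (allCube N) (λ t → *-identityʳ (m t)) ⟩
      M                                   ≤⟨ M≤1 ⟩
      1ℚ                                  ∎
      where open ≤-Reasoning

    ∑bias²≤ : ∑[ s ← allCube N ] (bias s * bias s) ≤ 1ℚ + τ
    ∑bias²≤ = begin
      ∑[ s ← allCube N ] (bias s * bias s)
        ≡⟨ ∑bias²≡ ⟩
      ∑[ t ← allCube N ] ∑[ t′ ← allCube N ] (m t * m t′ * ∑[ s ← allCube N ] (σ t s * σ t′ s))
        ≤⟨ ∑-mono-≤ (allCube N) (λ {t} _ → ∑-mono-≤ (allCube N) (λ {t′} _ →
             *-monoˡ-≤-nonNeg (m t * m t′) {{nonNegative (nonNeg*nonNeg (0≤m t) (0≤m t′))}} (∑σσ≤ t t′))) ⟩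
      ∑[ t ← allCube N ] ∑[ t′ ← allCube N ] (m t * m t′ * (δ t′ t * P + τ))
        ≡⟨ ∑∑mm[δP+τ]≡ ⟩
      ∑[ t ← allCube N ] (m t * P * m t) + τ * (M * M)
        ≤⟨ +-mono-≤ ∑mPm≤1 (≤-trans (*-monoˡ-≤-nonNeg τ {{nonNegative 0≤τ}} (*-mono-≤-nonNeg 0≤M 0≤M M≤1 M≤1))
                                     (≤-reflexive (*-identityʳ τ))) ⟩
      1ℚ + τ ∎
      where open ≤-Reasoning

    nearlyBalanced : ℚ → Subset N
    nearlyBalanced η s = does (∣ bias s ∣ <? η + η)

    #unbalanced*I< : ∀ {η} → 0ℚ < η → τ * I ≤ η * η * η → I ≤ η * η * η →
      ∑[ s ← allCube N ] 𝟙 (not (nearlyBalanced η s)) * I < η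
    #unbalanced*I< {η} 0<η τI≤η³ I≤η³ = *-cancelʳ-<-nonNeg (2η * 2η) {{nonNegative (<⇒≤ 0<4η²)}} (begin-strict
      #bad * I * (2η * 2η)            ≡⟨ solve 3 (λ a b c → a :* b :* c := (a :* c) :* b) refl #bad I (2η * 2η) ⟩
      #bad * (2η * 2η) * I            ≤⟨ *-monoʳ-≤-nonNeg I {{nonNegative (inv2^-nonNeg N)}} (≤-trans markov′ ∑bias²≤) ⟩
      (1ℚ + τ) * I                    ≡⟨ solve 2 (λ t i → (con 1ℚ :+ t) :* i := i :+ t :* i) refl τ I ⟩
      I + τ * I                       ≤⟨ +-mono-≤ I≤η³ τI≤η³ ⟩
      η * η * η + η * η * η           <⟨ ≤-<-trans (≤-reflexive (sym (+-identityʳ (η * η * η + η * η * η)))) (+-monoʳ-< (η * η * η + η * η * η) (+-mono-< 0<η³ 0<η³)) ⟩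
      (η * η * η + η * η * η) + (η * η * η + η * η * η)
                                      ≡⟨ solve 1 (λ d → (d :* d :* d :+ d :* d :* d) :+ (d :* d :* d :+ d :* d :* d)
                                                      := d :* ((d :+ d) :* (d :+ d))) refl η ⟩
      η * (2η * 2η)                   ∎)
      where
      open ≤-Reasoning
      2η = η + η
      #bad = ∑[ s ← allCube N ] 𝟙 (not (nearlyBalanced η s))
      0<η³ = pos*pos (pos*pos 0<η 0<η) 0<η
      0<4η² = pos*pos (+-mono-< 0<η 0<η) (+-mono-< 0<η 0<η)
      markov′ : #bad * (2η * 2η) ≤ ∑[ s ← allCube N ] (bias s * bias s)
      markov′ = ≤-trans (≤-reflexive (*-distribʳ-∑ (2η * 2η) (allCube N) _)) (markov (allCube N) bias (<⇒≤ (+-mono-< 0<η 0<η)))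

    translates-nearly-balanced : ∀ {η} → 0ℚ < η → τ * I ≤ η * η * η → I ≤ η * η * η →
      Σ (Subset N) λ T → (1ℚ - η < ℕ→ℚ (card T) * I) ×
        ((s : Cube N) → T s ≡ true → ∣ sumOver (translate F s) m - mass m * ½ ∣ < η)
    translates-nearly-balanced {η} 0<η τI≤η³ I≤η³ = nearlyBalanced η , many , close
      where
      open ≤-Reasoning
      T = nearlyBalanced η
      #bad = ∑[ s ← allCube N ] 𝟙 (not (T s))

      many : 1ℚ - η < ℕ→ℚ (card T) * I
      many = begin-strict
        1ℚ - η                  <⟨ +-monoʳ-< 1ℚ (neg-antimono-< (#unbalanced*I< 0<η τI≤η³ I≤η³)) ⟩
        1ℚ - #bad * I           ≡⟨ cong (_- #bad * I) (sym (trans (*-comm P I) (inv2^*2^ N))) ⟩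
        P * I - #bad * I        ≡⟨ solve 3 (λ p b i → p :* i :- b :* i := (p :- b) :* i) refl P #bad I ⟩
        (P - #bad) * I          ≡⟨ cong (_* I) #good≡ ⟩
        ℕ→ℚ (card T) * I        ∎
        where
        #good≡ : P - #bad ≡ ℕ→ℚ (card T)
        #good≡ = begin-equality
          P - #bad                                                         ≡⟨ cong (_- #bad) (sym (trans (∑-allCube-const N 1ℚ) (*-identityʳ P))) ⟩
          ∑[ s ← allCube N ] 1ℚ - #bad                                     ≡⟨ cong (_- #bad) (∑-cong (allCube N) (λ s → sym (𝟙+𝟙∘not (T s)))) ⟩
          ∑[ s ← allCube N ] (𝟙 (T s) + 𝟙 (not (T s))) - #bad              ≡⟨ cong (_- #bad) (∑-distrib-+ (allCube N) (𝟙 ∘ T) (𝟙 ∘ not ∘ T)) ⟩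
          ∑[ s ← allCube N ] 𝟙 (T s) + #bad - #bad                         ≡⟨ solve 2 (λ a b → a :+ b :- b := a) refl (∑[ s ← allCube N ] 𝟙 (T s)) #bad ⟩
          ∑[ s ← allCube N ] 𝟙 (T s)                                       ≡⟨ sym (length-filter≡∑𝟙 T (allCube N)) ⟩
          ℕ→ℚ (card T)                                                     ∎

      close : ∀ s → T s ≡ true → ∣ sumOver (translate F s) m - mass m * ½ ∣ < η
      close s Ts = begin-strict
        ∣ sumOver (translate F s) m - mass m * ½ ∣ ≡⟨ cong ∣_∣ (sumOver-translate s) ⟩
        ∣ ½ * bias s ∣                             ≡⟨ trans (∣p*q∣≡∣p∣*∣q∣ ½ (bias s)) (cong (_* ∣ bias s ∣) (0≤p⇒∣p∣≡p 0≤½)) ⟩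
        ½ * ∣ bias s ∣                             <⟨ *-monoʳ-<-pos ½ {{positive 0<½}} (∣bias∣<2η (∣ bias s ∣ <? η + η) Ts) ⟩
        ½ * (η + η)                                ≡⟨ solve 1 (λ d → con ½ :* (d :+ d) := d) refl η ⟩
        η                                          ∎
        where
        ∣bias∣<2η : (d : Dec (∣ bias s ∣ < η + η)) → does d ≡ true → ∣ bias s ∣ < η + η
        ∣bias∣<2η (yes ∣bias∣<2η) _  = ∣bias∣<2η
        ∣bias∣<2η (no  _)         ()

-- Choosing the parameters

∃inv2^≤δ³ : ∀ δ → 0ℚ < δ → ∃ λ e → inv2^ e ≤ δ * δ * δ × inv2^ e < δ
∃inv2^≤δ³ δ 0<δ with e₁ , inv2^e₁<δ³ ← ∃inv2^< (δ * δ * δ) (pos*pos (pos*pos 0<δ 0<δ) 0<δ)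
                   | e₂ , inv2^e₂<δ  ← ∃inv2^< δ 0<δ =
  e₁ ℕ.+ e₂ , ≤-trans (inv2^-antimono (ℕₚ.m≤m+n e₁ e₂)) (<⇒≤ inv2^e₁<δ³)
            , ≤-<-trans (inv2^-antimono (ℕₚ.m≤n+m e₂ e₁)) inv2^e₂<δ

-- m = 2(K + 1) powers of P on the right against K + (K + 1) on the left leave one factor P to spare.
moment-threshold : ∀ {P η B : ℚ} K → 0ℚ < P → ℕ→ℚ K * B < P * η ^ (suc K ℕ.+ suc K) →
  ℕ→ℚ K * P ^ K * (B * P ^ suc K) < (P * η) ^ (suc K ℕ.+ suc K)
moment-threshold {P} {η} {B} K 0<P KB<Pη^m = begin-strict
  ℕ→ℚ K * P ^ K * (B * P ^ suc K)     ≡⟨ solve 4 (λ k a b c → k :* a :* (b :* c) := (a :* c) :* (k :* b)) refl (ℕ→ℚ K) (P ^ K) B (P ^ suc K) ⟩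
  P ^ K * P ^ suc K * (ℕ→ℚ K * B)     ≡⟨ cong (_* (ℕ→ℚ K * B)) (sym (^-homo-* P K (suc K))) ⟩
  P ^ (K ℕ.+ suc K) * (ℕ→ℚ K * B)     <⟨ *-monoʳ-<-pos (P ^ (K ℕ.+ suc K)) {{positive (^-pos (K ℕ.+ suc K) 0<P)}} KB<Pη^m ⟩
  P ^ (K ℕ.+ suc K) * (P * η ^ m)     ≡⟨ solve 3 (λ a p b → a :* (p :* b) := (p :* a) :* b) refl (P ^ (K ℕ.+ suc K)) P (η ^ m) ⟩
  P ^ m * η ^ m                       ≡⟨ sym (^-distrib-* P η m) ⟩
  (P * η) ^ m                         ∎
  where
  open ≤-Reasoning
  m = suc K ℕ.+ suc K

inv2^-pos : ∀ n → 0ℚ < inv2^ n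
inv2^-pos n rewrite inv2^≡½^ n = ^-pos n 0<½

<2^N*inv2^ : ∀ {a} N d → a ℕ.* 2 ℕ.^ d ℕ.< 2 ℕ.^ N → ℕ→ℚ a < ℕ→ℚ (2 ℕ.^ N) * inv2^ d
<2^N*inv2^ {a} N d a2^d<2^N = begin-strict
  ℕ→ℚ a                                ≡⟨ sym (trans (cong (ℕ→ℚ a *_) (trans (*-comm (ℕ→ℚ (2 ℕ.^ d)) (inv2^ d)) (inv2^*2^ d))) (*-identityʳ (ℕ→ℚ a))) ⟩
  ℕ→ℚ a * (ℕ→ℚ (2 ℕ.^ d) * inv2^ d)    ≡⟨ trans (sym (*-assoc (ℕ→ℚ a) (ℕ→ℚ (2 ℕ.^ d)) (inv2^ d))) (cong (_* inv2^ d) (sym (ℕ→ℚ-* a (2 ℕ.^ d)))) ⟩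
  ℕ→ℚ (a ℕ.* 2 ℕ.^ d) * inv2^ d        <⟨ *-monoˡ-<-pos (inv2^ d) {{positive (inv2^-pos d)}} (ℕ→ℚ-mono-< a2^d<2^N) ⟩
  ℕ→ℚ (2 ℕ.^ N) * inv2^ d              ∎
  where open ≤-Reasoning

existenceThreshold : ℕ → ℕ → ℕ
existenceThreshold K e =
  let m = suc K ℕ.+ suc K ; Wₙ = nonFreeBound m K in K ℕ.* (Wₙ ℕ.+ Wₙ) ℕ.^ m ℕ.* 2 ℕ.^ (e ℕ.* m)

pseudorandom-exists : ∀ K e N → existenceThreshold K e ℕ.< 2 ℕ.^ N →
  ∃ λ (F : Subset N) → Pseudorandom K (ℕ→ℚ (2 ℕ.^ N) * inv2^ e) F
pseudorandom-exists K e N threshold<2^N =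
  small-moment⇒pseudorandom K (suc K) τ (nonNeg*nonNeg (ℕ→ℚ-nonNeg (2 ℕ.^ N)) (inv2^-nonNeg e))
    (moment-threshold K (ℕ→ℚ-mono-< (ℕₚ.m^n>0 2 N)) (begin-strict
      ℕ→ℚ K * (W + W) ^ m                       ≡⟨ cong (λ w → ℕ→ℚ K * w ^ m) (sym (ℕ→ℚ-+ Wₙ Wₙ)) ⟩
      ℕ→ℚ K * ℕ→ℚ (Wₙ ℕ.+ Wₙ) ^ m               ≡⟨ sym (trans (ℕ→ℚ-* K ((Wₙ ℕ.+ Wₙ) ℕ.^ m)) (cong (ℕ→ℚ K *_) (ℕ→ℚ-^ (Wₙ ℕ.+ Wₙ) m))) ⟩
      ℕ→ℚ (K ℕ.* (Wₙ ℕ.+ Wₙ) ℕ.^ m)            <⟨ <2^N*inv2^ {K ℕ.* (Wₙ ℕ.+ Wₙ) ℕ.^ m} N (e ℕ.* m) threshold<2^N ⟩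
      ℕ→ℚ (2 ℕ.^ N) * inv2^ (e ℕ.* m)          ≡⟨ cong (ℕ→ℚ (2 ℕ.^ N) *_) inv2^[e*m] ⟩
      ℕ→ℚ (2 ℕ.^ N) * inv2^ e ^ m              ∎))
  where
  open ≤-Reasoning
  m  = suc K ℕ.+ suc K
  Wₙ = nonFreeBound m K
  W  = ℕ→ℚ Wₙ
  τ  = ℕ→ℚ (2 ℕ.^ N) * inv2^ e
  inv2^[e*m] : inv2^ (e ℕ.* m) ≡ inv2^ e ^ m
  inv2^[e*m] rewrite inv2^≡½^ (e ℕ.* m) | inv2^≡½^ e = sym (^-assocʳ ½ e m)

+<⇒<2^ : ∀ t {e N} → t ℕ.+ e ℕ.< N → t ℕ.< 2 ℕ.^ N
+<⇒<2^ t {e} {N} t+e<N = ℕₚ.<-trans (ℕₚ.≤-<-trans (ℕₚ.m≤m+n t e) t+e<N) (n<2^n N)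

+<⇒≤ʳ : ∀ t {e N} → t ℕ.+ e ℕ.< N → e ℕ.≤ N
+<⇒≤ʳ t {e} t+e<N = ℕₚ.≤-trans (ℕₚ.m≤n+m e t) (ℕₚ.<⇒≤ t+e<N)

2^N*inv2^e*inv2^N : ∀ N e → ℕ→ℚ (2 ℕ.^ N) * inv2^ e * inv2^ N ≡ inv2^ e
2^N*inv2^e*inv2^N N e = trans (solve 3 (λ p a i → p :* a :* i := a :* (i :* p)) refl (ℕ→ℚ (2 ℕ.^ N)) (inv2^ e) (inv2^ N))
                              (trans (cong (inv2^ e *_) (inv2^*2^ N)) (*-identityʳ (inv2^ e)))

mainTheorem3 : (k : ℕ) (ε δ : ℚ) → 0ℚ < ε → 0ℚ < δ →
    Σ ℕ λ n → (N : ℕ) → n Data.Nat.< N →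
      Σ (Subset N) λ a0 →
        ((X : Subset N) → card X Data.Nat.≤ k →
          ∣ ℕ→ℚ (card (⋂translates a0 X)) * inv2^ N - inv2^ (card X) ∣ < δ)
        ×
        ((m : Cube N → ℚ) → ((x : Cube N) → (0ℚ ≤ m x) × (m x ≤ inv2^ N)) → ε ≤ mass m →
          Σ (Subset N) λ T → (1ℚ - δ < ℕ→ℚ (card T) * inv2^ N) ×
            ((s : Cube N) → T s ≡ true → ∣ sumOver (translate a0 s) m - mass m * ½ ∣ < δ))
mainTheorem3 k ε δ _ 0<δ = existenceThreshold K e ℕ.+ e , λ N n<N →
  let F , pseudorandom = pseudorandom-exists K e N (+<⇒<2^ (existenceThreshold K e) n<N)
      0≤τ = nonNeg*nonNeg (ℕ→ℚ-nonNeg (2 ℕ.^ N)) (inv2^-nonNeg e)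
      τI≡inv2^e = 2^N*inv2^e*inv2^N N e
  in F
   , (λ X |X|≤k → ≤-<-trans (pseudorandom⇒intersections F 0≤τ pseudorandom X (ℕₚ.≤-trans |X|≤k (ℕₚ.m≤n+m k 2)))
                            (≤-<-trans (≤-reflexive τI≡inv2^e) inv2^e<δ))
   , (λ m distribution _ → translates-nearly-balanced F m 0≤τ (s≤s (s≤s z≤n)) pseudorandom distribution 0<δ
                             (≤-trans (≤-reflexive τI≡inv2^e) inv2^e≤δ³)
                             (≤-trans (inv2^-antimono (+<⇒≤ʳ (existenceThreshold K e) n<N)) inv2^e≤δ³))
  where
  K = 2 ℕ.+ k
  e = proj₁ (∃inv2^≤δ³ δ 0<δ)
  inv2^e≤δ³ = proj₁ (proj₂ (∃inv2^≤δ³ δ 0<δ))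
  inv2^e<δ  = proj₂ (proj₂ (∃inv2^≤δ³ δ 0<δ))
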